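{- Let $0<q<1$, let $r,s\geq 0$ be integers, let $a,b,c,d\in\mathbb{C}$, $\mathbf{e}=(e_1,\dots,e_r)\in\mathbb{C}^r$ and $\mathbf{f}=(f_1,\dots,f_s)\in\mathbb{C}^s$, with the parameters such that all the basic hypergeometric series below are defined. Then, as an identity of power series in $z$, \begin{multline*} (a-b)(a-c)(bc-d)(1-d)\, {}_{r+4}\phi_{s+3}\!\left[\begin{matrix} a^{ -1}bc,\ bcq^{ -2},\ c,\ dq^{ -1},\ \mathbf{e}\\ aq^{ -1},\ bq^{ -1},\ bcd^{ -1},\ \mathbf{f}\end{matrix};q,z\right] {}_{r+4}\phi_{s+3}\!\left[\begin{matrix} a^{ -1}bc,\ bc,\ c,\ dq,\ \mathbf{e}q\\ aq,\ bq,\ bcd^{ -1},\ \mathbf{f}q\end{matrix};q,q^{s-r}z\right]\\ =(a-d)(1-b)(1-c)(bc-ad)\, {}_{r+4}\phi_{s+3}\!\left[\begin{matrix} a^{ -1}bc,\ bcq^{ -2},\ cq^{ -1},\ d,\ \mathbf{e}\\ aq^{ -1},\ b,\ bcd^{ -1}q^{ -1},\ \mathbf{f}\end{matrix};q,z\right] {}_{r+4}\phi_{s+3}\!\left[\begin{matrix} a^{ -1}bc,\ bc,\ cq,\ d,\ \mathbf{e}q\\ aq,\ b,\ bcd^{ -1}q,\ \mathbf{f}q\end{matrix};q,q^{s-r}z\right]\\ -(1-a)(b-d)(c-d)(a-bc)\, {}_{r+4}\phi_{s+3}\!\left[\begin{matrix} a^{ -1}bcq^{ -1},\ bcq^{ -2},\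 c,\ d,\ \mathbf{e}\\ a,\ bq^{ -1},\ bcd^{ -1}q^{ -1},\ \mathbf{f}\end{matrix};q,z\right] {}_{r+4}\phi_{s+3}\!\left[\begin{matrix} a^{ -1}bcq,\ bc,\ c,\ d,\ \mathbf{e}q\\ a,\ bq,\ bcd^{ -1}q,\ \mathbf{f}q\end{matrix};q,q^{s-r}z\right]. \end{multline*}
   Context: For $n\in\mathbb{Z}$: $(a;q)_\infty=\prod_{k\ge0}(1-aq^k)$, $(a;q)_n=(a;q)_\infty/(aq^n;q)_\infty$, and $(a_1,\dots,a_m;q)_n=\prod_i(a_i;q)_n$. The basic hypergeometric series is ${}_{R}\phi_{S}\left[\begin{matrix}\alpha_1,\dots,\alpha_R\\ \beta_1,\dots,\beta_S\end{matrix};q,z\right]=\sum_{n\ge0}\frac{(\alpha_1,\dots,\alpha_R;q)_n}{(q,\beta_1,\dots,\beta_S;q)_n}\left((-1)^nq^{\binom n2}\right)^{1+S-R}z^n.$ In the parameter lists, $\mathbf{e}$ stands for the entries $e_1,\dots,e_r$, $\mathbf{e}q$ for $e_1q,\dots,e_rq$, and similarly $\mathbf{f}$, $\mathbf{f}q$. -}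

module Defs where

open import Level using (Level; _⊔_) renaming (suc to lsuc)
open import Algebra.Bundles using (CommutativeRing)
open import Relation.Nullary using (¬_)
open import Data.Nat using (ℕ; zero; suc; _∸_)
open import Data.Nat.Combinatorics using (_C_)
open import Data.Integer using (ℤ; +_; -[1+_])
import Data.Integer as ℤ
open import Data.List using (List; []; _∷_; length)

-- A field: a commutative ring (with setoid equality) with 0 ≠ 1 and a total
-- inverse operation which is a genuine inverse on nonzero elements
-- (the value of 0 ⁻¹ is irrelevant).
record Field c ℓ : Set (lsuc (c ⊔ ℓ)) where
  field
    commutativeRing : CommutativeRing c ℓ
  open CommutativeRing commutativeRing public
  field
    _⁻¹        : Carrier → Carrier
    ⁻¹-cong    : ∀ {x y} → x ≈ y → (x ⁻¹) ≈ (y ⁻¹)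
    0≉1        : ¬ (0# ≈ 1#)
    ⁻¹-inverse : ∀ x → ¬ (x ≈ 0#) → (x * (x ⁻¹)) ≈ 1#

module FieldDefs {c ℓ : Level} (F : Field c ℓ) where
  open Field F hiding (zero)

  pow : Carrier → ℕ → Carrier
  pow x zero    = 1#
  pow x (suc n) = pow x n * x

  ipow : Carrier → ℤ → Carrier
  ipow x (+ n)     = pow x n
  ipow x -[1+ n ]  = (pow x (suc n)) ⁻¹

  poch : Carrier → Carrier → ℕ → Carrier
  poch a q zero    = 1#
  poch a q (suc n) = poch a q n * (1# - a * pow q n)

  pochs : List Carrier → Carrier → ℕ → Carrier
  pochs []       q n = 1#
  pochs (a ∷ as) q n = poch a q n * pochs as q n

  -- Coefficient of z^n in  _Rφ_S [αs ; βs ; q , w z]  (R = length αs, S = length βs),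
  -- i.e. the n-th term of the basic hypergeometric series with argument w·z,
  -- viewed as a formal power series in z.
  phi : List Carrier → List Carrier → Carrier → Carrier → ℕ → Carrier
  phi αs βs q w n =
    pochs αs q n * (poch q q n * pochs βs q n) ⁻¹
      * ipow (pow (- 1#) n * pow q (n C 2))
             ((+ (suc (length βs))) ℤ.- (+ (length αs)))
      * pow w n

  Defined : List Carrier → List Carrier → Carrier → Set ℓ
  Defined αs βs q = ∀ n → ¬ ((poch q q n * pochs βs q n) ≈ 0#)

  sumTo : (ℕ → Carrier) → ℕ → Carrier
  sumTo f zero    = f zero
  sumTo f (suc n) = sumTo f n + f (suc n)

  _⊛_ : (ℕ → Carrier) → (ℕ → Carrier) → ℕ → Carrier
  (f ⊛ g) N = sumTo (λ k → f k * g (N ∸ k)) N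

module Submission where

-- Each of the six series terms factors as a ratio of q-shifted factorials in the four numerator
-- and three denominator parameters written out in the theorem (the "core"), times a "tail"
-- carrying e, f and ((-1)^n q^(n choose 2))^(s-r) z^n.  The coefficient of z^N in the difference
-- of the two sides is therefore a sum over k + m = N of tail(k) tail'(m) core(k, m).  Because the
-- second factor of each product has parameters eq, fq and argument q^(s-r) z, the tails satisfy
-- tail(k+1) tail'(m) = tail(m+1) tail'(k); so the antidiagonal sum vanishes as soon as
-- core(0, m) = 0, core(k+1, k) = 0 and core(k+1, m) + core(m+1, k) = 0, its terms cancelling in
-- pairs.
--
-- For the core, pair each parameter with a partner of the same product p = bc: a with bc/a,
-- b with c, d with bc/d.  For every parameter x, the unshifted product (x;q)_k (x;q)_m and
-- the shifted one (x/q;q)_k (xq;q)_m share a common factor, and what is left is a product of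
-- linear factors 1 - x t; paired up, these are polynomials in the pair sums.  The three-term
-- combination then becomes an explicit polynomial identity.  For k ≥ 2, m ≥ 1 it equals
-- (q^(k-1) - q^m) times an expression symmetric under (k - 1, m) ↦ (m, k - 1), which gives both
-- the antisymmetry and the vanishing on the diagonal; the boundary indices are separate
-- identities of the same kind.

open import Defs
open import Algebra.Bundles using (CommutativeRing)
open import Data.Bool using (Bool; true; false)
open import Data.Integer as ℤ using (ℤ; +_; -[1+_])
import Data.Integer.Properties as ℤ
open import Data.List using (List; []; _∷_; _++_; map; length)
import Data.List.Properties as List
open import Data.Maybe using (nothing)
open import Data.Nat as ℕ using (ℕ; zero; suc; _∸_)
import Data.Nat.Properties as ℕ
open import Data.Nat.Combinatorics using (_C_; nC1≡n; nCk+nC[k+1]≡[n+1]C[k+1])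
open import Data.Sign as Sign using (Sign)
open import Data.Vec using (Vec; toList)
import Data.Vec.Properties as Vec
open import Level using (_⊔_)
open import Relation.Binary.PropositionalEquality as ≡ using (_≡_)
open import Relation.Nullary using (¬_)

-- Tactic.RingSolver over an arbitrary commutative ring takes its coefficients from the
-- ring itself and compares them only syntactically (1# + - 1# is not recognised as 0#);
-- with coefficients in ℤ, normal forms are compared by computation.
module IntegerCoefficientSolver {c ℓ} (R : CommutativeRing c ℓ) where
  open CommutativeRing R
  open import Algebra.Properties.Ring ring using (-‿distribˡ-*; -‿involutive; -‿+-comm; -0#≈0#)
  open import Algebra.Properties.Semiring.Mult.TCOptimised semiring using (_×_; 1+×; ×-homo-+; ×1-homo-*)
  open import Relation.Binary.Reasoning.Setoid setoid
  open import Algebra.Properties.CommutativeSemigroup *-commutativeSemigroup using (interchange)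
  open import Tactic.RingSolver.Core.AlmostCommutativeRing using (fromCommutativeRing)
  open import Tactic.RingSolver.Core.Polynomial.Parameters using (Homomorphism)

  ⟦_⟧ℤ : ℤ → Carrier
  ⟦ + n ⟧ℤ      = n × 1#
  ⟦ -[1+ n ] ⟧ℤ = - (suc n × 1#)

  private
    ⊖-homo : ∀ m n → ⟦ m ℤ.⊖ n ⟧ℤ ≈ m × 1# - n × 1#
    ⊖-homo zero    zero    = sym (-‿inverseʳ 0#)
    ⊖-homo zero    (suc n) = sym (+-identityˡ _)
    ⊖-homo (suc m) zero    = sym (trans (+-congˡ -0#≈0#) (+-identityʳ _))
    ⊖-homo (suc m) (suc n) = begin
      ⟦ suc m ℤ.⊖ suc n ⟧ℤ          ≡⟨ ≡.cong ⟦_⟧ℤ (ℤ.[1+m]⊖[1+n]≡m⊖n m n) ⟩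
      ⟦ m ℤ.⊖ n ⟧ℤ                  ≈⟨ ⊖-homo m n ⟩
      m × 1# - n × 1#               ≈⟨ cancel (m × 1#) (n × 1#) ⟨
      (1# + m × 1#) - (1# + n × 1#) ≈⟨ +-cong (1+× m 1#) (-‿cong (1+× n 1#)) ⟨
      suc m × 1# - suc n × 1#       ∎
      where
      cancel : ∀ x y → (1# + x) - (1# + y) ≈ x - y
      cancel x y = begin
        (1# + x) + - (1# + y)     ≈⟨ +-congˡ (-‿+-comm 1# y) ⟨
        (1# + x) + (- 1# + - y)   ≈⟨ +-assoc 1# x _ ⟩
        1# + (x + (- 1# + - y))   ≈⟨ +-congˡ (+-assoc x (- 1#) (- y)) ⟨
        1# + ((x + - 1#) + - y)   ≈⟨ +-congˡ (+-congʳ (+-comm x (- 1#))) ⟩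
        1# + ((- 1# + x) + - y)   ≈⟨ +-congˡ (+-assoc (- 1#) x (- y)) ⟩
        1# + (- 1# + (x + - y))   ≈⟨ +-assoc 1# (- 1#) _ ⟨
        (1# + - 1#) + (x + - y)   ≈⟨ +-congʳ (-‿inverseʳ 1#) ⟩
        0# + (x - y)              ≈⟨ +-identityˡ _ ⟩
        x - y                     ∎

    +-homo : ∀ i j → ⟦ i ℤ.+ j ⟧ℤ ≈ ⟦ i ⟧ℤ + ⟦ j ⟧ℤ
    +-homo -[1+ m ] -[1+ n ] = begin
      - (suc (suc (m ℕ.+ n)) × 1#)           ≡⟨ ≡.cong (λ k → - (suc k × 1#)) (ℕ.+-suc m n) ⟨
      - ((suc m ℕ.+ suc n) × 1#)             ≈⟨ -‿cong (×-homo-+ 1# (suc m) (suc n)) ⟩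
      - (suc m × 1# + suc n × 1#)            ≈⟨ -‿+-comm _ _ ⟨
      - (suc m × 1#) + - (suc n × 1#)        ∎
    +-homo -[1+ m ] (+ n)    = trans (⊖-homo n (suc m)) (+-comm _ _)
    +-homo (+ m)    -[1+ n ] = ⊖-homo m (suc n)
    +-homo (+ m)    (+ n)    = ×-homo-+ 1# m n

    ⟦_⟧ₛ : Sign → Carrier
    ⟦ Sign.+ ⟧ₛ = 1#
    ⟦ Sign.- ⟧ₛ = - 1#

    -1*x≈-x : ∀ x → - 1# * x ≈ - x
    -1*x≈-x x = trans (sym (-‿distribˡ-* 1# x)) (-‿cong (*-identityˡ x))

    sign-*-homo : ∀ s t → ⟦ s Sign.* t ⟧ₛ ≈ ⟦ s ⟧ₛ * ⟦ t ⟧ₛ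
    sign-*-homo Sign.- Sign.- = sym (trans (-1*x≈-x (- 1#)) (-‿involutive 1#))
    sign-*-homo Sign.- Sign.+ = sym (*-identityʳ _)
    sign-*-homo Sign.+ _      = sym (*-identityˡ _)

    ◃-homo : ∀ s n → ⟦ s ℤ.◃ n ⟧ℤ ≈ ⟦ s ⟧ₛ * (n × 1#)
    ◃-homo s      zero    = sym (zeroʳ _)
    ◃-homo Sign.+ (suc n) = sym (*-identityˡ _)
    ◃-homo Sign.- (suc n) = sym (-1*x≈-x _)

    sign-abs : ∀ i → ⟦ i ⟧ℤ ≈ ⟦ ℤ.sign i ⟧ₛ * (ℤ.∣ i ∣ × 1#)
    sign-abs (+ n)    = sym (*-identityˡ _)
    sign-abs -[1+ n ] = sym (-1*x≈-x _)

    *-homo : ∀ i j → ⟦ i ℤ.* j ⟧ℤ ≈ ⟦ i ⟧ℤ * ⟦ j ⟧ℤ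
    *-homo i j = begin
      ⟦ (ℤ.sign i Sign.* ℤ.sign j) ℤ.◃ (ℤ.∣ i ∣ ℕ.* ℤ.∣ j ∣) ⟧ℤ
        ≈⟨ ◃-homo (ℤ.sign i Sign.* ℤ.sign j) (ℤ.∣ i ∣ ℕ.* ℤ.∣ j ∣) ⟩
      ⟦ ℤ.sign i Sign.* ℤ.sign j ⟧ₛ * ((ℤ.∣ i ∣ ℕ.* ℤ.∣ j ∣) × 1#)
        ≈⟨ *-cong (sign-*-homo (ℤ.sign i) (ℤ.sign j)) (×1-homo-* ℤ.∣ i ∣ ℤ.∣ j ∣) ⟩
      (si * sj) * (ai * aj)
        ≈⟨ interchange si sj ai aj ⟩
      (si * ai) * (sj * aj)
        ≈⟨ *-cong (sign-abs i) (sign-abs j) ⟨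
      ⟦ i ⟧ℤ * ⟦ j ⟧ℤ ∎
      where
      si = ⟦ ℤ.sign i ⟧ₛ
      sj = ⟦ ℤ.sign j ⟧ₛ
      ai = ℤ.∣ i ∣ × 1#
      aj = ℤ.∣ j ∣ × 1#

    -‿homo : ∀ i → ⟦ ℤ.- i ⟧ℤ ≈ - ⟦ i ⟧ℤ
    -‿homo (+ zero)  = sym -0#≈0#
    -‿homo (+ suc n) = refl
    -‿homo -[1+ n ]  = sym (-‿involutive _)

    isZero : ℤ → Bool
    isZero (+ zero) = true
    isZero _        = false

    homomorphism : Homomorphism _ _ c ℓ
    homomorphism = record
      { from = record
        { rawRing = record { Carrier = ℤ ; _≈_ = _≡_ ; _+_ = ℤ._+_ ; _*_ = ℤ._*_ ; -_ = ℤ.-_ ; 0# = + 0 ; 1# = + 1 }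
        ; isZero  = isZero
        }
      ; to = fromCommutativeRing R (λ _ → nothing)
      ; morphism = record
        { ⟦_⟧ = ⟦_⟧ℤ ; +-homo = +-homo ; *-homo = *-homo ; -‿homo = -‿homo ; 0-homo = refl ; 1-homo = refl }
      ; Zero-C⟶Zero-R = λ { (+ zero) _ → refl }
      }

  open import Tactic.RingSolver.Core.Expression public using (Expr; Κ; Ι; _⊕_; _⊗_; ⊝_)
  open import Tactic.RingSolver.Core.Expression using (_⊛_; module Eval)
  open Eval rawRing ⟦_⟧ℤ using (⟦_⟧)
  open import Tactic.RingSolver.Core.Polynomial.Base (Homomorphism.from homomorphism)
  open import Tactic.RingSolver.Core.Polynomial.Semantics homomorphism renaming (⟦_⟧ to ⟦_⟧ₚ)
  open import Tactic.RingSolver.Core.Polynomial.Homomorphism homomorphism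
  open import Algebra.Properties.Semiring.Exp.TCOptimised semiring using (^-congˡ)

  private
    normalise : ∀ {n} → Expr ℤ n → Poly n
    normalise (Κ x)   = κ x
    normalise (Ι x)   = ι x
    normalise (x ⊕ y) = normalise x ⊞ normalise y
    normalise (x ⊗ y) = normalise x ⊠ normalise y
    normalise (⊝ x)   = ⊟ normalise x
    normalise (x ⊛ i) = normalise x ⊡ i

    ⟦_⇓⟧ : ∀ {n} → Expr ℤ n → Vec Carrier n → Carrier
    ⟦ e ⇓⟧ = ⟦ normalise e ⟧ₚ

    correct : ∀ {n} (e : Expr ℤ n) ρ → ⟦ e ⇓⟧ ρ ≈ ⟦ e ⟧ ρ
    correct (Κ x)   ρ = κ-hom x ρ
    correct (Ι x)   ρ = ι-hom x ρ
    correct (x ⊕ y) ρ = trans (⊞-hom (normalise x) (normalise y) ρ) (+-cong (correct x ρ) (correct y ρ))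
    correct (x ⊗ y) ρ = trans (⊠-hom (normalise x) (normalise y) ρ) (*-cong (correct x ρ) (correct y ρ))
    correct (⊝ x)   ρ = trans (⊟-hom (normalise x) ρ) (-‿cong (correct x ρ))
    correct (x ⊛ i) ρ = trans (⊡-hom (normalise x) i ρ) (^-congˡ i (correct x ρ))

  open import Relation.Binary.Reflection setoid Ι ⟦_⟧ ⟦_⇓⟧ correct public using (solve; _⊜_)

  infixl 6 _⊖_
  _⊖_ : ∀ {n} → Expr ℤ n → Expr ℤ n → Expr ℤ n
  x ⊖ y = x ⊕ ⊝ y

  𝟙 : ∀ {n} → Expr ℤ n
  𝟙 = Κ (+ 1)

module FieldProperties {c ℓ} (F : Field c ℓ) where
  open Field F hiding (zero)
  open FieldDefs F
  open import Algebra.Properties.Ring ring using (-‿involutive; -0#≈0#)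
  open import Algebra.Properties.CommutativeSemigroup *-commutativeSemigroup using (interchange; xy∙z≈xz∙y)
  open import Relation.Binary.Reasoning.Setoid setoid

  infix 4 _≉0
  _≉0 : Carrier → Set ℓ
  x ≉0 = ¬ (x ≈ 0#)

  infixl 7 _/_
  _/_ : Carrier → Carrier → Carrier
  x / y = x * y ⁻¹

  1≉0 : 1# ≉0
  1≉0 1≈0 = 0≉1 (sym 1≈0)

  -1≉0 : - 1# ≉0
  -1≉0 -1≈0 = 1≉0 (trans (sym (-‿involutive 1#)) (trans (-‿cong -1≈0) -0#≈0#))

  ≉0-resp : ∀ {x y} → x ≈ y → x ≉0 → y ≉0
  ≉0-resp x≈y x≉0 y≈0 = x≉0 (trans x≈y y≈0)

  ≉0-*ˡ : ∀ {x y} → x * y ≉0 → x ≉0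
  ≉0-*ˡ {x} {y} xy≉0 x≈0 = xy≉0 (trans (*-congʳ x≈0) (zeroˡ y))

  ≉0-*ʳ : ∀ {x y} → x * y ≉0 → y ≉0
  ≉0-*ʳ {x} {y} xy≉0 y≈0 = xy≉0 (trans (*-congˡ y≈0) (zeroʳ x))

  ⁻¹-inverseʳ : ∀ {x} → x ≉0 → x * x ⁻¹ ≈ 1#
  ⁻¹-inverseʳ {x} = ⁻¹-inverse x

  ⁻¹-inverseˡ : ∀ {x} → x ≉0 → x ⁻¹ * x ≈ 1#
  ⁻¹-inverseˡ x≉0 = trans (*-comm _ _) (⁻¹-inverseʳ x≉0)

  *-cancelʳ : ∀ {x y z} → z ≉0 → x * z ≈ y * z → x ≈ y
  *-cancelʳ {x} {y} {z} z≉0 eq = begin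
    x                ≈⟨ *-identityʳ x ⟨
    x * 1#           ≈⟨ *-congˡ (⁻¹-inverseʳ z≉0) ⟨
    x * (z * z ⁻¹)   ≈⟨ *-assoc x z _ ⟨
    (x * z) * z ⁻¹   ≈⟨ *-congʳ eq ⟩
    (y * z) * z ⁻¹   ≈⟨ *-assoc y z _ ⟩
    y * (z * z ⁻¹)   ≈⟨ *-congˡ (⁻¹-inverseʳ z≉0) ⟩
    y * 1#           ≈⟨ *-identityʳ y ⟩
    y                ∎

  ≉0-* : ∀ {x y} → x ≉0 → y ≉0 → x * y ≉0
  ≉0-* {x} {y} x≉0 y≉0 xy≈0 = y≉0 (*-cancelʳ x≉0 (begin
    y * x  ≈⟨ *-comm y x ⟩
    x * y  ≈⟨ xy≈0 ⟩
    0#     ≈⟨ zeroˡ x ⟨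
    0# * x ∎))

  ⁻¹-unique : ∀ {x y} → x ≉0 → x * y ≈ 1# → x ⁻¹ ≈ y
  ⁻¹-unique {x} {y} x≉0 xy≈1 = *-cancelʳ x≉0 (trans (⁻¹-inverseˡ x≉0) (trans (sym xy≈1) (*-comm x y)))

  ⁻¹-distrib-* : ∀ {x y} → x ≉0 → y ≉0 → (x * y) ⁻¹ ≈ x ⁻¹ * y ⁻¹
  ⁻¹-distrib-* {x} {y} x≉0 y≉0 = ⁻¹-unique (≉0-* x≉0 y≉0) (begin
    (x * y) * (x ⁻¹ * y ⁻¹)   ≈⟨ interchange x y _ _ ⟩
    (x * x ⁻¹) * (y * y ⁻¹)   ≈⟨ *-cong (⁻¹-inverseʳ x≉0) (⁻¹-inverseʳ y≉0) ⟩
    1# * 1#                   ≈⟨ *-identityˡ 1# ⟩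
    1#                        ∎)

  /-cong : ∀ {x x' y y'} → x ≈ x' → y ≈ y' → x / y ≈ x' / y'
  /-cong x≈x' y≈y' = *-cong x≈x' (⁻¹-cong y≈y')

  /-*-interchange : ∀ {w x y z} → x ≉0 → z ≉0 → (w / x) * (y / z) ≈ (w * y) / (x * z)
  /-*-interchange {w} {x} {y} {z} x≉0 z≉0 = begin
    (w * x ⁻¹) * (y * z ⁻¹)   ≈⟨ interchange w _ y _ ⟩
    (w * y) * (x ⁻¹ * z ⁻¹)   ≈⟨ *-congˡ (⁻¹-distrib-* x≉0 z≉0) ⟨
    (w * y) / (x * z)         ∎

  /-extend : ∀ {x y} z → y ≉0 → z ≉0 → x / y ≈ (x * z) / (y * z)
  /-extend {x} {y} z y≉0 z≉0 = begin
    x * y ⁻¹                  ≈⟨ *-identityʳ _ ⟨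
    x * y ⁻¹ * 1#             ≈⟨ *-congˡ (⁻¹-inverseʳ z≉0) ⟨
    x * y ⁻¹ * (z * z ⁻¹)     ≈⟨ interchange x _ z _ ⟩
    (x * z) * (y ⁻¹ * z ⁻¹)   ≈⟨ *-congˡ (⁻¹-distrib-* y≉0 z≉0) ⟨
    (x * z) / (y * z)         ∎

  pow-cong : ∀ {x y} n → x ≈ y → pow x n ≈ pow y n
  pow-cong zero    x≈y = refl
  pow-cong (suc n) x≈y = *-cong (pow-cong n x≈y) x≈y

  pow-≉0 : ∀ {x} n → x ≉0 → pow x n ≉0
  pow-≉0 zero    x≉0 = 1≉0
  pow-≉0 (suc n) x≉0 = ≉0-* (pow-≉0 n x≉0) x≉0

  pow-1# : ∀ n → pow 1# n ≈ 1#
  pow-1# zero    = refl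
  pow-1# (suc n) = trans (*-identityʳ _) (pow-1# n)

  pow-distrib-* : ∀ x y n → pow (x * y) n ≈ pow x n * pow y n
  pow-distrib-* x y zero    = sym (*-identityˡ 1#)
  pow-distrib-* x y (suc n) = trans (*-congʳ (pow-distrib-* x y n)) (interchange _ _ x y)

  pow-+ : ∀ x m n → pow x (m ℕ.+ n) ≈ pow x m * pow x n
  pow-+ x zero    n = sym (*-identityˡ _)
  pow-+ x (suc m) n = trans (*-congʳ (pow-+ x m n)) (xy∙z≈xz∙y _ _ x)

  pow-pow-comm : ∀ x m n → pow (pow x m) n ≈ pow (pow x n) m
  pow-pow-comm x m zero    = sym (pow-1# m)
  pow-pow-comm x m (suc n) = trans (*-congʳ (pow-pow-comm x m n)) (sym (pow-distrib-* (pow x n) x m))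

  pow-⁻¹ : ∀ {x} n → x ≉0 → pow (x ⁻¹) n ≈ pow x n ⁻¹
  pow-⁻¹ zero    x≉0 = sym (⁻¹-unique 1≉0 (*-identityˡ 1#))
  pow-⁻¹ (suc n) x≉0 = trans (*-congʳ (pow-⁻¹ n x≉0)) (sym (⁻¹-distrib-* (pow-≉0 n x≉0) x≉0))

  ipow-cong : ∀ {x y} z → x ≈ y → ipow x z ≈ ipow y z
  ipow-cong (+ n)    x≈y = pow-cong n x≈y
  ipow-cong -[1+ n ] x≈y = ⁻¹-cong (pow-cong (suc n) x≈y)

  ipow-distrib-* : ∀ {x y} z → x ≉0 → y ≉0 → ipow (x * y) z ≈ ipow x z * ipow y z
  ipow-distrib-* {x} {y} (+ n)    x≉0 y≉0 = pow-distrib-* x y n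
  ipow-distrib-* {x} {y} -[1+ n ] x≉0 y≉0 =
    trans (⁻¹-cong (pow-distrib-* x y (suc n))) (⁻¹-distrib-* (pow-≉0 (suc n) x≉0) (pow-≉0 (suc n) y≉0))

  pow-ipow : ∀ {x} n z → x ≉0 → pow (ipow x z) n ≈ ipow (pow x n) z
  pow-ipow {x} n (+ m)    x≉0 = pow-pow-comm x m n
  pow-ipow {x} n -[1+ m ] x≉0 = trans (pow-⁻¹ n (pow-≉0 (suc m) x≉0)) (⁻¹-cong (pow-pow-comm x (suc m) n))

  /-cancelˡ : ∀ {x y z} → z ≉0 → y ≉0 → (z * x) / (z * y) ≈ x / y
  /-cancelˡ {x} {y} {z} z≉0 y≉0 = sym (trans (/-extend z y≉0 z≉0) (/-cong (*-comm x z) (*-comm y z)))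

  /-+-≈0 : ∀ {x y x' y'} → y ≉0 → y' ≉0 → x * y' + x' * y ≈ 0# → x / y + x' / y' ≈ 0#
  /-+-≈0 {x} {y} {x'} {y'} y≉0 y'≉0 cross≈0 = begin
    x / y + x' / y'                              ≈⟨ +-cong (/-extend y' y≉0 y'≉0) (/-extend y y'≉0 y≉0) ⟩
    (x * y') / (y * y') + (x' * y) / (y' * y)    ≈⟨ +-congˡ (/-cong refl (*-comm y' y)) ⟩
    (x * y') / (y * y') + (x' * y) / (y * y')    ≈⟨ distribʳ _ _ _ ⟨
    (x * y' + x' * y) / (y * y')                 ≈⟨ *-congʳ cross≈0 ⟩
    0# * (y * y') ⁻¹                             ≈⟨ zeroˡ _ ⟩
    0#                                           ∎

module Pochhammer {ℓ₁ ℓ₂} (F : Field ℓ₁ ℓ₂) (q : Field.Carrier F) where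
  open Field F hiding (zero)
  open FieldDefs F
  open FieldProperties F
  open IntegerCoefficientSolver commutativeRing
  open import Algebra.Properties.CommutativeSemigroup *-commutativeSemigroup using (interchange; xy∙z≈xz∙y)
  open import Data.Product using (_×_; _,_; proj₁; proj₂)
  open import Relation.Binary.Reasoning.Setoid setoid

  qi : Carrier
  qi = q ⁻¹

  poch-cong : ∀ {x y} n → x ≈ y → poch x q n ≈ poch y q n
  poch-cong zero    x≈y = refl
  poch-cong (suc n) x≈y = *-cong (poch-cong n x≈y) (+-congˡ (-‿cong (*-congʳ x≈y)))

  poch-shift : ∀ x n → poch x q (suc n) ≈ (1# - x * 1#) * poch (x * q) q n
  poch-shift x zero    = *-comm 1# _
  poch-shift x (suc n) = trans (*-congʳ (poch-shift x n))
    (solve 5 (λ x q u P qn → (u ⊗ P) ⊗ (𝟙 ⊖ x ⊗ (qn ⊗ q)) ⊜ u ⊗ (P ⊗ (𝟙 ⊖ (x ⊗ q) ⊗ qn)))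
      refl x q (1# - x * 1#) (poch (x * q) q n) (pow q n))

  pochs-++ : ∀ xs ys n → pochs (xs ++ ys) q n ≈ pochs xs q n * pochs ys q n
  pochs-++ []       ys n = sym (*-identityˡ _)
  pochs-++ (x ∷ xs) ys n = trans (*-congˡ (pochs-++ xs ys n)) (sym (*-assoc _ _ _))

  poch-shift-sym : ∀ e k m → poch e q (suc k) * poch (e * q) q m ≈ poch e q (suc m) * poch (e * q) q k
  poch-shift-sym e k m = begin
    poch e q (suc k) * poch (e * q) q m            ≈⟨ *-congʳ (poch-shift e k) ⟩
    (1# - e * 1#) * poch (e * q) q k * poch (e * q) q m
      ≈⟨ xy∙z≈xz∙y _ _ _ ⟩
    (1# - e * 1#) * poch (e * q) q m * poch (e * q) q k ≈⟨ *-congʳ (poch-shift e m) ⟨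
    poch e q (suc m) * poch (e * q) q k            ∎

  pochs-shift-sym : ∀ es k m →
    pochs es q (suc k) * pochs (map (_* q) es) q m ≈ pochs es q (suc m) * pochs (map (_* q) es) q k
  pochs-shift-sym []       k m = refl
  pochs-shift-sym (e ∷ es) k m = begin
    (poch e q (suc k) * pochs es q (suc k)) * (poch (e * q) q m * pochs (map (_* q) es) q m)
      ≈⟨ interchange _ _ _ _ ⟩
    (poch e q (suc k) * poch (e * q) q m) * (pochs es q (suc k) * pochs (map (_* q) es) q m)
      ≈⟨ *-cong (poch-shift-sym e k m) (pochs-shift-sym es k m) ⟩
    (poch e q (suc m) * poch (e * q) q k) * (pochs es q (suc m) * pochs (map (_* q) es) q k)
      ≈⟨ interchange _ _ _ _ ⟩
    (poch e q (suc m) * pochs es q (suc m)) * (poch (e * q) q k * pochs (map (_* q) es) q k) ∎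

  linFactors : List Carrier → Carrier → Carrier
  linFactors []       x = 1#
  linFactors (t ∷ ts) x = (1# - x * t) * linFactors ts x

  linFactors-++ : ∀ ts us x → linFactors (ts ++ us) x ≈ linFactors ts x * linFactors us x
  linFactors-++ []       us x = sym (*-identityˡ _)
  linFactors-++ (t ∷ ts) us x = trans (*-congˡ (linFactors-++ ts us x)) (sym (*-assoc _ _ _))

  prod : List Carrier → Carrier
  prod []       = 1#
  prod (x ∷ xs) = x * prod xs

  infixr 5 _∷_
  data Factorisation (k m : ℕ) : (xs ys gs ss : List Carrier) → Set (ℓ₁ ⊔ ℓ₂) where
    []  : Factorisation k m [] [] [] []
    _∷_ : ∀ {x y g s xs ys gs ss} → poch x q k * poch y q m ≈ g * s →
          Factorisation k m xs ys gs ss → Factorisation k m (x ∷ xs) (y ∷ ys) (g ∷ gs) (s ∷ ss)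

  pochs-factorisation : ∀ {k m xs ys gs ss} → Factorisation k m xs ys gs ss →
                        pochs xs q k * pochs ys q m ≈ prod gs * prod ss
  pochs-factorisation []         = refl
  pochs-factorisation (eq ∷ eqs) =
    trans (interchange _ _ _ _) (trans (*-cong eq (pochs-factorisation eqs)) (interchange _ _ _ _))

  factorisation-≉0 : ∀ {k m xs ys gs ss} → Factorisation k m xs ys gs ss →
                     pochs xs q k ≉0 → pochs ys q m ≉0 → prod gs ≉0 × prod ss ≉0
  factorisation-≉0 eqs xs≉0 ys≉0 = ≉0-*ˡ gs*ss≉0 , ≉0-*ʳ gs*ss≉0
    where gs*ss≉0 = ≉0-resp (pochs-factorisation eqs) (≉0-* xs≉0 ys≉0)

  ratio : List Carrier → List Carrier → ℕ → Carrier
  ratio ns ds n = pochs ns q n / pochs (q ∷ ds) q n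

  ratio-factorisation : ∀ {k m ns ns' ds ds' gn sn gd sd} →
    Factorisation k m ns ns' gn sn → Factorisation k m (q ∷ ds) (q ∷ ds') gd sd →
    pochs (q ∷ ds) q k ≉0 → pochs (q ∷ ds') q m ≉0 →
    ratio ns ds k * ratio ns' ds' m ≈ (prod gn / prod gd) * (prod sn / prod sd)
  ratio-factorisation {k} {m} {ns} {ns'} {ds} {ds'} {gn} {sn} {gd} {sd} num den dsk≉0 ds'm≉0 = begin
    ratio ns ds k * ratio ns' ds' m
      ≈⟨ /-*-interchange dsk≉0 ds'm≉0 ⟩
    (pochs ns q k * pochs ns' q m) / (pochs (q ∷ ds) q k * pochs (q ∷ ds') q m)
      ≈⟨ /-cong (pochs-factorisation num) (pochs-factorisation den) ⟩
    (prod gn * prod sn) / (prod gd * prod sd)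
      ≈⟨ /-*-interchange gd≉0 sd≉0 ⟨
    (prod gn / prod gd) * (prod sn / prod sd) ∎
    where
    gd≉0 = proj₁ (factorisation-≉0 den dsk≉0 ds'm≉0)
    sd≉0 = proj₂ (factorisation-≉0 den dsk≉0 ds'm≉0)

  record SlotFactorisation (k m : ℕ) : Set (ℓ₁ ⊔ ℓ₂) where
    field
      common          : Carrier → Carrier
      plainTs shiftTs : List Carrier
      plain           : ∀ x → poch x q k * poch x q m ≈ common x * linFactors plainTs x
      shifted         : ∀ x → poch (x * qi) q k * poch (x * q) q m ≈ common x * linFactors shiftTs x

  slot : ∀ ts us {A B g h x} → A ≈ g * linFactors ts x → B ≈ h * linFactors us x →
         A * B ≈ (g * h) * linFactors (ts ++ us) x
  slot ts us {g = g} {h} {x} A≈ B≈ = begin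
    _ * _                                        ≈⟨ *-cong A≈ B≈ ⟩
    (g * linFactors ts x) * (h * linFactors us x) ≈⟨ interchange _ _ _ _ ⟩
    (g * h) * (linFactors ts x * linFactors us x) ≈⟨ *-congˡ (linFactors-++ ts us x) ⟨
    (g * h) * linFactors (ts ++ us) x            ∎

  split-0 : ∀ x → poch x q 0 ≈ 1# * linFactors [] x
  split-0 x = sym (*-identityʳ 1#)

  split-1+ : ∀ x n → poch x q (suc n) ≈ poch (x * q) q n * linFactors (1# ∷ []) x
  split-1+ x n = trans (poch-shift x n) (trans (*-comm _ _) (*-congˡ (sym (*-identityʳ _))))

  split-2+ : ∀ x n → poch x q (suc (suc n)) ≈ poch (x * q) q n * linFactors (1# ∷ pow q (suc n) ∷ []) x
  split-2+ x n = begin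
    poch x q (suc n) * (1# - x * pow q (suc n))
      ≈⟨ *-congʳ (split-1+ x n) ⟩
    poch (x * q) q n * ((1# - x * 1#) * 1#) * (1# - x * pow q (suc n))
      ≈⟨ solve 4 (λ P u v o → P ⊗ (u ⊗ o) ⊗ v ⊜ P ⊗ (u ⊗ (v ⊗ o))) refl _ (1# - x * 1#) _ 1# ⟩
    poch (x * q) q n * linFactors (1# ∷ pow q (suc n) ∷ []) x ∎

  split*q-1+ : ∀ x n → poch (x * q) q (suc n) ≈ poch (x * q) q n * linFactors (pow q (suc n) ∷ []) x
  split*q-1+ x n = *-congˡ (begin
    1# - x * q * pow q n        ≈⟨ +-congˡ (-‿cong (solve 3 (λ x q qn → x ⊗ q ⊗ qn ⊜ x ⊗ (qn ⊗ q)) refl x q (pow q n))) ⟩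
    1# - x * pow q (suc n)      ≈⟨ *-identityʳ _ ⟨
    (1# - x * pow q (suc n)) * 1# ∎)

  module _ (q≉0 : q ≉0) where

    *qi*q : ∀ x → x * qi * q ≈ x
    *qi*q x = trans (*-assoc x qi q) (trans (*-congˡ (⁻¹-inverseˡ q≉0)) (*-identityʳ x))

    split*qi-1+ : ∀ x n → poch (x * qi) q (suc n) ≈ poch x q n * linFactors (qi ∷ []) x
    split*qi-1+ x n = begin
      poch (x * qi) q (suc n)                          ≈⟨ poch-shift (x * qi) n ⟩
      (1# - x * qi * 1#) * poch (x * qi * q) q n       ≈⟨ *-cong (+-congˡ (-‿cong (*-identityʳ _))) (poch-cong n (*qi*q x)) ⟩
      (1# - x * qi) * poch x q n                       ≈⟨ *-comm _ _ ⟩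
      poch x q n * (1# - x * qi)                       ≈⟨ *-congˡ (*-identityʳ _) ⟨
      poch x q n * linFactors (qi ∷ []) x              ∎

    split*qi-2+ : ∀ x n → poch (x * qi) q (suc (suc n)) ≈ poch (x * q) q n * linFactors (qi ∷ 1# ∷ []) x
    split*qi-2+ x n = begin
      poch (x * qi) q (suc (suc n))                    ≈⟨ split*qi-1+ x (suc n) ⟩
      poch x q (suc n) * linFactors (qi ∷ []) x        ≈⟨ *-congʳ (split-1+ x n) ⟩
      poch (x * q) q n * linFactors (1# ∷ []) x * linFactors (qi ∷ []) x
        ≈⟨ solve 3 (λ P u v → P ⊗ (u ⊗ 𝟙) ⊗ (v ⊗ 𝟙) ⊜ P ⊗ (v ⊗ (u ⊗ 𝟙))) refl _ (1# - x * 1#) (1# - x * qi) ⟩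
      poch (x * q) q n * linFactors (qi ∷ 1# ∷ []) x   ∎

    open SlotFactorisation

    slots-2+-1+ : ∀ K M → SlotFactorisation (suc (suc K)) (suc M)
    slots-2+-1+ K M = record
      { common  = λ x → poch (x * q) q K * poch (x * q) q M
      ; plainTs = 1# ∷ pow q (suc K) ∷ 1# ∷ []
      ; shiftTs = qi ∷ 1# ∷ pow q (suc M) ∷ []
      ; plain   = λ x → slot (1# ∷ pow q (suc K) ∷ []) (1# ∷ []) (split-2+ x K) (split-1+ x M)
      ; shifted = λ x → slot (qi ∷ 1# ∷ []) (pow q (suc M) ∷ []) (split*qi-2+ x K) (split*q-1+ x M)
      }

    slots-1-1+ : ∀ M → SlotFactorisation 1 (suc M)
    slots-1-1+ M = record
      { common  = λ x → 1# * poch (x * q) q M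
      ; plainTs = 1# ∷ 1# ∷ []
      ; shiftTs = qi ∷ pow q (suc M) ∷ []
      ; plain   = λ x → slot (1# ∷ []) (1# ∷ []) (split-1+ x 0) (split-1+ x M)
      ; shifted = λ x → slot (qi ∷ []) (pow q (suc M) ∷ []) (split*qi-1+ x 0) (split*q-1+ x M)
      }

    slots-2+-0 : ∀ M → SlotFactorisation (suc (suc M)) 0
    slots-2+-0 M = record
      { common  = λ x → poch (x * q) q M * 1#
      ; plainTs = 1# ∷ pow q (suc M) ∷ []
      ; shiftTs = qi ∷ 1# ∷ []
      ; plain   = λ x → slot (1# ∷ pow q (suc M) ∷ []) [] (split-2+ x M) (split-0 x)
      ; shifted = λ x → slot (qi ∷ 1# ∷ []) [] (split*qi-2+ x M) (split-0 x)
      }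

    slots-1-0 : SlotFactorisation 1 0
    slots-1-0 = record
      { common  = λ x → 1# * 1#
      ; plainTs = 1# ∷ []
      ; shiftTs = qi ∷ []
      ; plain   = λ x → slot (1# ∷ []) [] (split-1+ x 0) (split-0 x)
      ; shifted = λ x → slot (qi ∷ []) [] (split*qi-1+ x 0) (split-0 x)
      }

    slots-0-1+ : ∀ M → SlotFactorisation 0 (suc M)
    slots-0-1+ M = record
      { common  = λ x → 1# * poch (x * q) q M
      ; plainTs = 1# ∷ []
      ; shiftTs = pow q (suc M) ∷ []
      ; plain   = λ x → slot [] (1# ∷ []) (split-0 x) (split-1+ x M)
      ; shifted = λ x → slot [] (pow q (suc M) ∷ []) (split-0 x) (split*q-1+ x M)
      }

    slots-0-0 : SlotFactorisation 0 0
    slots-0-0 = record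
      { common  = λ x → 1# * 1#
      ; plainTs = []
      ; shiftTs = []
      ; plain   = λ x → slot [] [] {x = x} (split-0 x) (split-0 x)
      ; shifted = λ x → slot [] [] {x = x} (split-0 x) (split-0 x)
      }

module ThreeTermBrackets {c ℓ} (R : CommutativeRing c ℓ) where
  open CommutativeRing R
  open IntegerCoefficientSolver R

  -- (1 - u t)(1 - v t) when u + v = s and u v = p
  lin : Carrier → Carrier → Carrier → Carrier
  lin p t s = 1# - s * t + p * (t * t)

  linPairs : Carrier → List Carrier → Carrier → Carrier
  linPairs p []       s = 1#
  linPairs p (t ∷ ts) s = lin p t s * linPairs p ts s

  -- The three-term combination of the theorem once each parameter has been paired with its
  -- partner of product p: Π collects the unshifted and Π′ the shifted pairs, as functions of
  -- the pair sums.
  bracket : (p κ sA sC sD : Carrier) (Π Π′ : Carrier → Carrier) → Carrier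
  bracket p κ sA sC sD Π Π′ =
      κ * (sA - sC) * (1# - sD + p) * (Π sA * Π sC * Π′ sD)
    - κ * (sA - sD) * (1# - sC + p) * (Π sA * Π′ sC * Π sD)
    + κ * (sC - sD) * (1# - sA + p) * (Π′ sA * Π sC * Π sD)

  private
    linE : ∀ {n} → Expr ℤ n → Expr ℤ n → Expr ℤ n → Expr ℤ n
    linE p t s = 𝟙 ⊖ s ⊗ t ⊕ p ⊗ (t ⊗ t)

    linPairsE : ∀ {n} → Expr ℤ n → List (Expr ℤ n) → Expr ℤ n → Expr ℤ n
    linPairsE p []       s = 𝟙
    linPairsE p (t ∷ ts) s = linE p t s ⊗ linPairsE p ts s

    bracketE : ∀ {n} (p κ sA sC sD : Expr ℤ n) (Π Π′ : Expr ℤ n → Expr ℤ n) → Expr ℤ n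
    bracketE p κ sA sC sD Π Π′ =
        κ ⊗ (sA ⊖ sC) ⊗ (𝟙 ⊖ sD ⊕ p) ⊗ (Π sA ⊗ Π sC ⊗ Π′ sD)
      ⊖ κ ⊗ (sA ⊖ sD) ⊗ (𝟙 ⊖ sC ⊕ p) ⊗ (Π sA ⊗ Π′ sC ⊗ Π sD)
      ⊕ κ ⊗ (sC ⊖ sD) ⊗ (𝟙 ⊖ sA ⊕ p) ⊗ (Π′ sA ⊗ Π sC ⊗ Π sD)

  bracket-const : ∀ p κ sA sC sD → bracket p κ sA sC sD (λ _ → 1#) (λ _ → 1#) ≈ 0#
  bracket-const = solve 5 (λ p κ sA sC sD → bracketE p κ sA sC sD (λ _ → 𝟙) (λ _ → 𝟙) ⊜ Κ (+ 0)) refl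

  bracket-affine : ∀ p κ sA sC sD t →
    bracket p κ sA sC sD (linPairs p (1# ∷ [])) (linPairs p (t ∷ [])) ≈ 0#
  bracket-affine = solve 6 (λ p κ sA sC sD t →
    bracketE p κ sA sC sD (linPairsE p (𝟙 ∷ [])) (linPairsE p (t ∷ [])) ⊜ Κ (+ 0)) refl

  genericCoefficient : (p κ sA sC sD : Carrier) → Carrier
  genericCoefficient p κ sA sC sD = κ * ((sA - sC) * (sA - sD) * (sC - sD)) * (δ * δ)
    where δ = (1# - sA + p) * (1# - sC + p) * (1# - sD + p)

  bracket-generic : ∀ p κ sA sC sD Q X Y →
    bracket p κ sA sC sD (linPairs p (1# ∷ X ∷ 1# ∷ [])) (linPairs p (Q ∷ 1# ∷ Y ∷ []))
    ≈ (X - Y) * (genericCoefficient p κ sA sC sD * ((Q - X) * ((1# - p * Q * X) * (p * X * Y - 1#))))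
  bracket-generic = solve 8 (λ p κ sA sC sD Q X Y →
    bracketE p κ sA sC sD (linPairsE p (𝟙 ∷ X ∷ 𝟙 ∷ [])) (linPairsE p (Q ∷ 𝟙 ∷ Y ∷ []))
    ⊜ (X ⊖ Y) ⊗ (coefficientE p κ sA sC sD ⊗ ((Q ⊖ X) ⊗ ((𝟙 ⊖ p ⊗ Q ⊗ X) ⊗ (p ⊗ X ⊗ Y ⊖ 𝟙))))) refl
    where
    coefficientE : ∀ {n} (p κ sA sC sD : Expr ℤ n) → Expr ℤ n
    coefficientE p κ sA sC sD = κ ⊗ ((sA ⊖ sC) ⊗ (sA ⊖ sD) ⊗ (sC ⊖ sD)) ⊗ (δ ⊗ δ)
      where δ = (𝟙 ⊖ sA ⊕ p) ⊗ (𝟙 ⊖ sC ⊕ p) ⊗ (𝟙 ⊖ sD ⊕ p)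

  bracket-edge : ∀ p κ sA sC sD Q Y →
      (1# - p * Q * Y) * (Q - Y) * bracket p κ sA sC sD (linPairs p (1# ∷ 1# ∷ [])) (linPairs p (Q ∷ Y ∷ []))
    + (1# - p * Q) * (Q - 1#) * bracket p κ sA sC sD (linPairs p (1# ∷ Y ∷ [])) (linPairs p (Q ∷ 1# ∷ []))
    ≈ 0#
  bracket-edge = solve 7 (λ p κ sA sC sD Q Y →
      (𝟙 ⊖ p ⊗ Q ⊗ Y) ⊗ (Q ⊖ Y) ⊗ bracketE p κ sA sC sD (linPairsE p (𝟙 ∷ 𝟙 ∷ [])) (linPairsE p (Q ∷ Y ∷ []))
    ⊕ (𝟙 ⊖ p ⊗ Q) ⊗ (Q ⊖ 𝟙) ⊗ bracketE p κ sA sC sD (linPairsE p (𝟙 ∷ Y ∷ [])) (linPairsE p (Q ∷ 𝟙 ∷ []))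
    ⊜ Κ (+ 0)) refl

module ThreeTermCore {ℓ₁ ℓ₂} (F : Field ℓ₁ ℓ₂) (q a b c d : Field.Carrier F) where
  open import Data.Product using (proj₂)
  open Field F hiding (zero)
  open FieldDefs F
  open FieldProperties F
  open Pochhammer F q
  open IntegerCoefficientSolver commutativeRing
  open import Algebra.Properties.CommutativeSemigroup *-commutativeSemigroup using (interchange; x∙yz≈y∙xz)
  open import Relation.Binary.Reasoning.Setoid setoid

  p α Δ : Carrier
  p  = b * c
  α  = a ⁻¹ * b * c
  Δ  = b * c * d ⁻¹

  numL₁ numR₁ denL₁ denR₁ numL₂ numR₂ denL₂ denR₂ numL₃ numR₃ denL₃ denR₃ : List Carrier
  numL₁ = α ∷ p * qi * qi ∷ c ∷ d * qi ∷ []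
  numR₁ = α ∷ p ∷ c ∷ d * q ∷ []
  denL₁ = a * qi ∷ b * qi ∷ Δ ∷ []
  denR₁ = a * q ∷ b * q ∷ Δ ∷ []
  numL₂ = α ∷ p * qi * qi ∷ c * qi ∷ d ∷ []
  numR₂ = α ∷ p ∷ c * q ∷ d ∷ []
  denL₂ = a * qi ∷ b ∷ Δ * qi ∷ []
  denR₂ = a * q ∷ b ∷ Δ * q ∷ []
  numL₃ = α * qi ∷ p * qi * qi ∷ c ∷ d ∷ []
  numR₃ = α * q ∷ p ∷ c ∷ d ∷ []
  denL₃ = a ∷ b * qi ∷ Δ * qi ∷ []
  denR₃ = a ∷ b * q ∷ Δ * q ∷ []

  C₁ C₂ C₃ : Carrier
  C₁ = (a - b) * (a - c) * (b * c - d) * (1# - d)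
  C₂ = (a - d) * (1# - b) * (1# - c) * (b * c - a * d)
  C₃ = (1# - a) * (b - d) * (c - d) * (a - b * c)

  core : ℕ → ℕ → Carrier
  core k m = C₁ * (ratio numL₁ denL₁ k * ratio numR₁ denR₁ m)
           - C₂ * (ratio numL₂ denL₂ k * ratio numR₂ denR₂ m)
           + C₃ * (ratio numL₃ denL₃ k * ratio numR₃ denR₃ m)

  record DenominatorsNonzero (k m : ℕ) : Set ℓ₂ where
    field
      L₁ : pochs (q ∷ denL₁) q k ≉0
      R₁ : pochs (q ∷ denR₁) q m ≉0
      L₂ : pochs (q ∷ denL₂) q k ≉0
      R₂ : pochs (q ∷ denR₂) q m ≉0
      L₃ : pochs (q ∷ denL₃) q k ≉0
      R₃ : pochs (q ∷ denR₃) q m ≉0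

  private
    linFactorsE : ∀ {n} → List (Expr ℤ n) → Expr ℤ n → Expr ℤ n
    linFactorsE []       x = 𝟙
    linFactorsE (t ∷ ts) x = (𝟙 ⊖ x ⊗ t) ⊗ linFactorsE ts x

  module _ (q≉0 : q ≉0) (a≉0 : a ≉0) (d≉0 : d ≉0) where
    open ThreeTermBrackets commutativeRing

    sA sC sD κ : Carrier
    sA = α + a
    sC = c + b
    sD = d + Δ
    κ  = - (a * d)

    α*a≈p : α * a ≈ p
    α*a≈p = begin
      a ⁻¹ * b * c * a    ≈⟨ solve 4 (λ a' b c a → a' ⊗ b ⊗ c ⊗ a ⊜ (a' ⊗ a) ⊗ (b ⊗ c)) refl (a ⁻¹) b c a ⟩
      (a ⁻¹ * a) * p      ≈⟨ *-congʳ (⁻¹-inverseˡ a≉0) ⟩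
      1# * p              ≈⟨ *-identityˡ p ⟩
      p                   ∎

    c*b≈p : c * b ≈ p
    c*b≈p = *-comm c b

    d*Δ≈p : d * Δ ≈ p
    d*Δ≈p = begin
      d * (b * c * d ⁻¹)  ≈⟨ solve 4 (λ d b c d' → d ⊗ (b ⊗ c ⊗ d') ⊜ (d ⊗ d') ⊗ (b ⊗ c)) refl d b c (d ⁻¹) ⟩
      (d * d ⁻¹) * p      ≈⟨ *-congʳ (⁻¹-inverseʳ d≉0) ⟩
      1# * p              ≈⟨ *-identityˡ p ⟩
      p                   ∎

    -- Modulo the relations α a = c b = d Δ = p, each Cᵢ depends only on the pair sums sA, sC, sD.
    private
      mod-relations : ∀ {R x y} s t → x ≈ p → y ≈ p → R + s * (x - p) + t * (y - p) ≈ R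
      mod-relations {R} s t x≈p y≈p = begin
        R + s * (_ - p) + t * (_ - p) ≈⟨ +-cong (+-congˡ (*-congˡ (vanish x≈p))) (*-congˡ (vanish y≈p)) ⟩
        R + s * 0# + t * 0#           ≈⟨ +-cong (+-congˡ (zeroʳ s)) (zeroʳ t) ⟩
        R + 0# + 0#                   ≈⟨ trans (+-identityʳ _) (+-identityʳ R) ⟩
        R                             ∎
        where
        vanish : ∀ {z} → z ≈ p → z - p ≈ 0#
        vanish z≈p = trans (+-congʳ z≈p) (-‿inverseʳ p)

    C₁≈ : C₁ ≈ κ * (sA - sC) * (1# - sD + p)
    C₁≈ = trans
      (solve 6 (λ a α b c d Δ → (a ⊖ b) ⊗ (a ⊖ c) ⊗ (b ⊗ c ⊖ d) ⊗ (𝟙 ⊖ d)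
         ⊜ (⊝ (a ⊗ d)) ⊗ ((α ⊕ a) ⊖ (c ⊕ b)) ⊗ (𝟙 ⊖ (d ⊕ Δ) ⊕ b ⊗ c)
           ⊕ (d ⊖ d ⊗ Δ ⊖ d ⊗ d ⊕ b ⊗ c ⊗ d) ⊗ (α ⊗ a ⊖ b ⊗ c)
           ⊕ (a ⊗ c ⊕ a ⊗ b ⊖ b ⊗ c ⊖ a ⊗ a) ⊗ (d ⊗ Δ ⊖ b ⊗ c)) refl a α b c d Δ)
      (mod-relations _ _ α*a≈p d*Δ≈p)

    C₂≈ : C₂ ≈ κ * (sA - sD) * (1# - sC + p)
    C₂≈ = trans
      (solve 6 (λ a α b c d Δ → (a ⊖ d) ⊗ (𝟙 ⊖ b) ⊗ (𝟙 ⊖ c) ⊗ (b ⊗ c ⊖ a ⊗ d)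
         ⊜ (⊝ (a ⊗ d)) ⊗ ((α ⊕ a) ⊖ (d ⊕ Δ)) ⊗ (𝟙 ⊖ (c ⊕ b) ⊕ b ⊗ c)
           ⊕ (d ⊖ c ⊗ d ⊖ b ⊗ d ⊕ b ⊗ c ⊗ d) ⊗ (α ⊗ a ⊖ b ⊗ c)
           ⊕ (a ⊗ c ⊕ a ⊗ b ⊖ a ⊖ a ⊗ b ⊗ c) ⊗ (d ⊗ Δ ⊖ b ⊗ c)) refl a α b c d Δ)
      (mod-relations _ _ α*a≈p d*Δ≈p)

    C₃≈ : C₃ ≈ κ * (sC - sD) * (1# - sA + p)
    C₃≈ = trans
      (solve 6 (λ a α b c d Δ → (𝟙 ⊖ a) ⊗ (b ⊖ d) ⊗ (c ⊖ d) ⊗ (a ⊖ b ⊗ c)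
         ⊜ (⊝ (a ⊗ d)) ⊗ ((c ⊕ b) ⊖ (d ⊕ Δ)) ⊗ (𝟙 ⊖ (α ⊕ a) ⊕ b ⊗ c)
           ⊕ (d ⊗ Δ ⊕ d ⊗ d ⊖ c ⊗ d ⊖ b ⊗ d) ⊗ (α ⊗ a ⊖ b ⊗ c)
           ⊕ (b ⊗ c ⊖ a ⊖ a ⊗ b ⊗ c ⊕ a ⊗ a) ⊗ (d ⊗ Δ ⊖ b ⊗ c)) refl a α b c d Δ)
      (mod-relations _ _ α*a≈p d*Δ≈p)

    linFactors-pair : ∀ ts {u v} → u * v ≈ p → linFactors ts u * linFactors ts v ≈ linPairs p ts (u + v)
    linFactors-pair []       u*v≈p = *-identityˡ 1#
    linFactors-pair (t ∷ ts) {u} {v} u*v≈p = begin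
      ((1# - u * t) * linFactors ts u) * ((1# - v * t) * linFactors ts v)
        ≈⟨ interchange _ _ _ _ ⟩
      ((1# - u * t) * (1# - v * t)) * (linFactors ts u * linFactors ts v)
        ≈⟨ *-cong pair (linFactors-pair ts u*v≈p) ⟩
      lin p t (u + v) * linPairs p ts (u + v) ∎
      where
      pair : (1# - u * t) * (1# - v * t) ≈ lin p t (u + v)
      pair = trans (solve 3 (λ u v t → (𝟙 ⊖ u ⊗ t) ⊗ (𝟙 ⊖ v ⊗ t) ⊜ 𝟙 ⊖ (u ⊕ v) ⊗ t ⊕ (u ⊗ v) ⊗ (t ⊗ t)) refl u v t)
                   (+-congˡ (*-congʳ u*v≈p))

    private
      rewrite-fraction : ∀ {x y e x' D} → y ≉0 → e ≉0 → y * e ≈ D → x * e ≈ x' → x / y ≈ x' / D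
      rewrite-fraction {e = e} y≉0 e≉0 ye≈D xe≈x' = trans (/-extend e y≉0 e≉0) (/-cong xe≈x' ye≈D)

    bracketOf : (π σ : Carrier → Carrier) → Carrier
    bracketOf π σ = C₁ * ((π α * π a) * (π c * π b) * (σ d * σ Δ))
                  - C₂ * ((π α * π a) * (σ c * σ b) * (π d * π Δ))
                  + C₃ * ((σ α * σ a) * (π c * π b) * (π d * π Δ))

    U D : (π σ : Carrier → Carrier) → Carrier
    U π σ = (π a * σ a) * ((π b * σ b) * (π Δ * σ Δ))
    D π σ = π q * U π σ

    commonRatio : (Carrier → Carrier) → Carrier
    commonRatio g = prod (g α ∷ g (p * qi) ∷ g c ∷ g d ∷ []) / prod (g q ∷ g a ∷ g b ∷ g Δ ∷ [])

    commonRatio-cong : ∀ {f g} → (∀ x → f x ≈ g x) → commonRatio f ≈ commonRatio g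
    commonRatio-cong f≈g = /-cong (≈₄ (f≈g α) (f≈g (p * qi)) (f≈g c) (f≈g d)) (≈₄ (f≈g q) (f≈g a) (f≈g b) (f≈g Δ))
      where
      ≈₄ : ∀ {w w' x x' y y' z z'} → w ≈ w' → x ≈ x' → y ≈ y' → z ≈ z' →
           prod (w ∷ x ∷ y ∷ z ∷ []) ≈ prod (w' ∷ x' ∷ y' ∷ z' ∷ [])
      ≈₄ w x y z = *-cong w (*-cong x (*-cong y (*-cong z refl)))

    three-fractions : ∀ (π σ : Carrier → Carrier) P →
      π q ≉0 → π a ≉0 → σ a ≉0 → π b ≉0 → σ b ≉0 → π Δ ≉0 → σ Δ ≉0 →
        C₁ * (prod (π α ∷ P ∷ π c ∷ σ d ∷ []) / prod (π q ∷ σ a ∷ σ b ∷ π Δ ∷ []))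
      - C₂ * (prod (π α ∷ P ∷ σ c ∷ π d ∷ []) / prod (π q ∷ σ a ∷ π b ∷ σ Δ ∷ []))
      + C₃ * (prod (σ α ∷ P ∷ π c ∷ π d ∷ []) / prod (π q ∷ π a ∷ σ b ∷ σ Δ ∷ []))
      ≈ (P * bracketOf π σ) / D π σ
    three-fractions π σ P πq πa σa πb σb πΔ σΔ = begin
        C₁ * (prod (π α ∷ P ∷ π c ∷ σ d ∷ []) / prod (π q ∷ σ a ∷ σ b ∷ π Δ ∷ []))
      - C₂ * (prod (π α ∷ P ∷ σ c ∷ π d ∷ []) / prod (π q ∷ σ a ∷ π b ∷ σ Δ ∷ []))
      + C₃ * (prod (σ α ∷ P ∷ π c ∷ π d ∷ []) / prod (π q ∷ π a ∷ σ b ∷ σ Δ ∷ []))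
        ≈⟨ +-cong (+-cong (*-congˡ fraction₁) (-‿cong (*-congˡ fraction₂))) (*-congˡ fraction₃) ⟩
      C₁ * ((P * T₁) / D π σ) - C₂ * ((P * T₂) / D π σ) + C₃ * ((P * T₃) / D π σ)
        ≈⟨ solve 8 (λ C₁ C₂ C₃ P T₁ T₂ T₃ D' →
             C₁ ⊗ ((P ⊗ T₁) ⊗ D') ⊖ C₂ ⊗ ((P ⊗ T₂) ⊗ D') ⊕ C₃ ⊗ ((P ⊗ T₃) ⊗ D')
             ⊜ (P ⊗ (C₁ ⊗ T₁ ⊖ C₂ ⊗ T₂ ⊕ C₃ ⊗ T₃)) ⊗ D') refl C₁ C₂ C₃ P T₁ T₂ T₃ (D π σ ⁻¹) ⟩
      (P * bracketOf π σ) / D π σ ∎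
      where
      T₁ = (π α * π a) * (π c * π b) * (σ d * σ Δ)
      T₂ = (π α * π a) * (σ c * σ b) * (π d * π Δ)
      T₃ = (σ α * σ a) * (π c * π b) * (π d * π Δ)
      nz₄ : ∀ {w x y z} → w ≉0 → x ≉0 → y ≉0 → z ≉0 → prod (w ∷ x ∷ y ∷ z ∷ []) ≉0
      nz₄ w x y z = ≉0-* w (≉0-* x (≉0-* y (≉0-* z 1≉0)))
      fraction₁ = rewrite-fraction (nz₄ πq σa σb πΔ) (≉0-* (≉0-* πa πb) σΔ)
        (solve 7 (λ Q πa σa πb σb πΔ σΔ → Q ⊗ (σa ⊗ (σb ⊗ (πΔ ⊗ 𝟙))) ⊗ (πa ⊗ πb ⊗ σΔ)
                    ⊜ Q ⊗ ((πa ⊗ σa) ⊗ ((πb ⊗ σb) ⊗ (πΔ ⊗ σΔ)))) refl (π q) (π a) (σ a) (π b) (σ b) (π Δ) (σ Δ))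
        (solve 7 (λ P πα πa πc πb σd σΔ → πα ⊗ (P ⊗ (πc ⊗ (σd ⊗ 𝟙))) ⊗ (πa ⊗ πb ⊗ σΔ)
                    ⊜ P ⊗ ((πα ⊗ πa) ⊗ (πc ⊗ πb) ⊗ (σd ⊗ σΔ))) refl P (π α) (π a) (π c) (π b) (σ d) (σ Δ))
      fraction₂ = rewrite-fraction (nz₄ πq σa πb σΔ) (≉0-* (≉0-* πa σb) πΔ)
        (solve 7 (λ Q πa σa πb σb πΔ σΔ → Q ⊗ (σa ⊗ (πb ⊗ (σΔ ⊗ 𝟙))) ⊗ (πa ⊗ σb ⊗ πΔ)
                    ⊜ Q ⊗ ((πa ⊗ σa) ⊗ ((πb ⊗ σb) ⊗ (πΔ ⊗ σΔ)))) refl (π q) (π a) (σ a) (π b) (σ b) (π Δ) (σ Δ))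
        (solve 7 (λ P πα πa σc σb πd πΔ → πα ⊗ (P ⊗ (σc ⊗ (πd ⊗ 𝟙))) ⊗ (πa ⊗ σb ⊗ πΔ)
                    ⊜ P ⊗ ((πα ⊗ πa) ⊗ (σc ⊗ σb) ⊗ (πd ⊗ πΔ))) refl P (π α) (π a) (σ c) (σ b) (π d) (π Δ))
      fraction₃ = rewrite-fraction (nz₄ πq πa σb σΔ) (≉0-* (≉0-* σa πb) πΔ)
        (solve 7 (λ Q πa σa πb σb πΔ σΔ → Q ⊗ (πa ⊗ (σb ⊗ (σΔ ⊗ 𝟙))) ⊗ (σa ⊗ πb ⊗ πΔ)
                    ⊜ Q ⊗ ((πa ⊗ σa) ⊗ ((πb ⊗ σb) ⊗ (πΔ ⊗ σΔ)))) refl (π q) (π a) (σ a) (π b) (σ b) (π Δ) (σ Δ))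
        (solve 7 (λ P σα σa πc πb πd πΔ → σα ⊗ (P ⊗ (πc ⊗ (πd ⊗ 𝟙))) ⊗ (σa ⊗ πb ⊗ πΔ)
                    ⊜ P ⊗ ((σα ⊗ σa) ⊗ (πc ⊗ πb) ⊗ (πd ⊗ πΔ))) refl P (σ α) (σ a) (π c) (π b) (π d) (π Δ))

    bracketOf≈bracket : ∀ ts us → bracketOf (linFactors ts) (linFactors us)
                                  ≈ bracket p κ sA sC sD (linPairs p ts) (linPairs p us)
    bracketOf≈bracket ts us = +-cong (+-cong (*-cong C₁≈ (*-cong (*-cong πA πC) σD)) (-‿cong (*-cong C₂≈ (*-cong (*-cong πA σC) πD))))
                                     (*-cong C₃≈ (*-cong (*-cong σA πC) πD))
      where
      πA = linFactors-pair ts α*a≈p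
      σA = linFactors-pair us α*a≈p
      πC = linFactors-pair ts c*b≈p
      σC = linFactors-pair us c*b≈p
      πD = linFactors-pair ts d*Δ≈p
      σD = linFactors-pair us d*Δ≈p

    module Factorised {k m} (S : SlotFactorisation k m) (nz : DenominatorsNonzero k m) where
      open SlotFactorisation S public
      open DenominatorsNonzero nz

      π σ : Carrier → Carrier
      π = linFactors plainTs
      σ = linFactors shiftTs

      P : Carrier
      P = σ (p * qi)

      Gn Gd : List Carrier
      Gn = common α ∷ common (p * qi) ∷ common c ∷ common d ∷ []
      Gd = common q ∷ common a ∷ common b ∷ common Δ ∷ []

      p-slot : poch (p * qi * qi) q k * poch p q m ≈ common (p * qi) * P
      p-slot = trans (*-congˡ (poch-cong m (sym (*qi*q q≉0 p)))) (shifted (p * qi))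

      num₁ : Factorisation k m numL₁ numR₁ Gn (π α ∷ P ∷ π c ∷ σ d ∷ [])
      num₁ = plain α ∷ p-slot ∷ plain c ∷ shifted d ∷ []
      den₁ : Factorisation k m (q ∷ denL₁) (q ∷ denR₁) Gd (π q ∷ σ a ∷ σ b ∷ π Δ ∷ [])
      den₁ = plain q ∷ shifted a ∷ shifted b ∷ plain Δ ∷ []
      num₂ : Factorisation k m numL₂ numR₂ Gn (π α ∷ P ∷ σ c ∷ π d ∷ [])
      num₂ = plain α ∷ p-slot ∷ shifted c ∷ plain d ∷ []
      den₂ : Factorisation k m (q ∷ denL₂) (q ∷ denR₂) Gd (π q ∷ σ a ∷ π b ∷ σ Δ ∷ [])
      den₂ = plain q ∷ shifted a ∷ plain b ∷ shifted Δ ∷ []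
      num₃ : Factorisation k m numL₃ numR₃ Gn (σ α ∷ P ∷ π c ∷ π d ∷ [])
      num₃ = shifted α ∷ p-slot ∷ plain c ∷ plain d ∷ []
      den₃ : Factorisation k m (q ∷ denL₃) (q ∷ denR₃) Gd (π q ∷ π a ∷ σ b ∷ σ Δ ∷ [])
      den₃ = plain q ∷ plain a ∷ shifted b ∷ shifted Δ ∷ []

      private
        den₁≉0 = proj₂ (factorisation-≉0 den₁ L₁ R₁)
        den₂≉0 = proj₂ (factorisation-≉0 den₂ L₂ R₂)
        den₃≉0 = proj₂ (factorisation-≉0 den₃ L₃ R₃)
        πq≉0 = ≉0-*ˡ den₁≉0
        σa≉0 = ≉0-*ˡ (≉0-*ʳ den₁≉0)
        σb≉0 = ≉0-*ˡ (≉0-*ʳ (≉0-*ʳ den₁≉0))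
        πΔ≉0 = ≉0-*ˡ (≉0-*ʳ (≉0-*ʳ (≉0-*ʳ den₁≉0)))
        πb≉0 = ≉0-*ˡ (≉0-*ʳ (≉0-*ʳ den₂≉0))
        σΔ≉0 = ≉0-*ˡ (≉0-*ʳ (≉0-*ʳ (≉0-*ʳ den₂≉0)))
        πa≉0 = ≉0-*ˡ (≉0-*ʳ den₃≉0)

      D≉0 : D π σ ≉0
      D≉0 = ≉0-* πq≉0 (≉0-* (≉0-* πa≉0 σa≉0) (≉0-* (≉0-* πb≉0 σb≉0) (≉0-* πΔ≉0 σΔ≉0)))

      core≈ : core k m ≈ commonRatio common * ((P * bracket p κ sA sC sD (linPairs p plainTs) (linPairs p shiftTs)) / D π σ)
      core≈ = begin
        core k m
          ≈⟨ +-cong (+-cong (*-congˡ (ratio-factorisation num₁ den₁ L₁ R₁)) (-‿cong (*-congˡ (ratio-factorisation num₂ den₂ L₂ R₂))))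
                    (*-congˡ (ratio-factorisation num₃ den₃ L₃ R₃)) ⟩
        C₁ * (G * f₁) - C₂ * (G * f₂) + C₃ * (G * f₃)
          ≈⟨ solve 7 (λ C₁ C₂ C₃ G f₁ f₂ f₃ → C₁ ⊗ (G ⊗ f₁) ⊖ C₂ ⊗ (G ⊗ f₂) ⊕ C₃ ⊗ (G ⊗ f₃)
                                              ⊜ G ⊗ (C₁ ⊗ f₁ ⊖ C₂ ⊗ f₂ ⊕ C₃ ⊗ f₃)) refl C₁ C₂ C₃ G f₁ f₂ f₃ ⟩
        G * (C₁ * f₁ - C₂ * f₂ + C₃ * f₃)
          ≈⟨ *-congˡ (three-fractions π σ P πq≉0 πa≉0 σa≉0 πb≉0 σb≉0 πΔ≉0 σΔ≉0) ⟩
        G * ((P * bracketOf π σ) / D π σ)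
          ≈⟨ *-congˡ (/-cong (*-congˡ (bracketOf≈bracket plainTs shiftTs)) refl) ⟩
        G * ((P * bracket p κ sA sC sD (linPairs p plainTs) (linPairs p shiftTs)) / D π σ) ∎
        where
        G  = commonRatio common
        f₁ = prod (π α ∷ P ∷ π c ∷ σ d ∷ []) / prod (π q ∷ σ a ∷ σ b ∷ π Δ ∷ [])
        f₂ = prod (π α ∷ P ∷ σ c ∷ π d ∷ []) / prod (π q ∷ σ a ∷ π b ∷ σ Δ ∷ [])
        f₃ = prod (σ α ∷ P ∷ π c ∷ π d ∷ []) / prod (π q ∷ π a ∷ σ b ∷ σ Δ ∷ [])

      core-vanishes : bracket p κ sA sC sD (linPairs p plainTs) (linPairs p shiftTs) ≈ 0# → core k m ≈ 0#
      core-vanishes bracket≈0 = begin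
        core k m                                    ≈⟨ core≈ ⟩
        commonRatio common * ((P * _) / D π σ)     ≈⟨ *-congˡ (*-congʳ (trans (*-congˡ bracket≈0) (zeroʳ P))) ⟩
        commonRatio common * (0# * D π σ ⁻¹)       ≈⟨ trans (*-congˡ (zeroˡ _)) (zeroʳ _) ⟩
        0#                                          ∎

    core-0-0 : DenominatorsNonzero 0 0 → core 0 0 ≈ 0#
    core-0-0 nz = Factorised.core-vanishes (slots-0-0 q≉0) nz (bracket-const p κ sA sC sD)

    core-0-1+ : ∀ M → DenominatorsNonzero 0 (suc M) → core 0 (suc M) ≈ 0#
    core-0-1+ M nz = Factorised.core-vanishes (slots-0-1+ q≉0 M) nz (bracket-affine p κ sA sC sD (pow q (suc M)))

    core-1-0 : DenominatorsNonzero 1 0 → core 1 0 ≈ 0#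
    core-1-0 nz = Factorised.core-vanishes (slots-1-0 q≉0) nz (bracket-affine p κ sA sC sD qi)

    q*qi≈1 : q * qi ≈ 1#
    q*qi≈1 = ⁻¹-inverseʳ q≉0

    edge-cancellation : ∀ Y →
        (1# - p * qi * Y) * (1# - q * Y) * bracket p κ sA sC sD (linPairs p (1# ∷ 1# ∷ [])) (linPairs p (qi ∷ Y ∷ []))
      + (1# - p * qi) * (1# - q) * bracket p κ sA sC sD (linPairs p (1# ∷ Y ∷ [])) (linPairs p (qi ∷ 1# ∷ []))
      ≈ 0#
    edge-cancellation Y = begin
      (1# - p * qi * Y) * (1# - q * Y) * B₁ + (1# - p * qi) * (1# - q) * B₂
        ≈⟨ +-cong (*-congʳ (*-congˡ (+-congʳ (sym q*qi≈1)))) (*-congʳ (*-congˡ (+-congʳ (sym q*qi≈1)))) ⟩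
      (1# - p * qi * Y) * (q * qi - q * Y) * B₁ + (1# - p * qi) * (q * qi - q) * B₂
        ≈⟨ solve 6 (λ p q qi Y B₁ B₂ →
             (𝟙 ⊖ p ⊗ qi ⊗ Y) ⊗ (q ⊗ qi ⊖ q ⊗ Y) ⊗ B₁ ⊕ (𝟙 ⊖ p ⊗ qi) ⊗ (q ⊗ qi ⊖ q) ⊗ B₂
             ⊜ q ⊗ ((𝟙 ⊖ p ⊗ qi ⊗ Y) ⊗ (qi ⊖ Y) ⊗ B₁ ⊕ (𝟙 ⊖ p ⊗ qi) ⊗ (qi ⊖ 𝟙) ⊗ B₂)) refl p q qi Y B₁ B₂ ⟩
      q * ((1# - p * qi * Y) * (qi - Y) * B₁ + (1# - p * qi) * (qi - 1#) * B₂)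
        ≈⟨ *-congˡ (bracket-edge p κ sA sC sD qi Y) ⟩
      q * 0#
        ≈⟨ zeroʳ q ⟩
      0# ∎
      where
      B₁ = bracket p κ sA sC sD (linPairs p (1# ∷ 1# ∷ [])) (linPairs p (qi ∷ Y ∷ []))
      B₂ = bracket p κ sA sC sD (linPairs p (1# ∷ Y ∷ [])) (linPairs p (qi ∷ 1# ∷ []))

    core-1-1+ : ∀ M → DenominatorsNonzero 1 (suc M) → DenominatorsNonzero (suc (suc M)) 0 →
                core 1 (suc M) + core (suc (suc M)) 0 ≈ 0#
    core-1-1+ M nz₁ nz₂ = begin
      core 1 (suc M) + core (suc (suc M)) 0
        ≈⟨ +-cong F₁.core≈ (trans F₂.core≈ (*-congʳ (commonRatio-cong (λ x → *-comm _ 1#)))) ⟩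
      G * x₁ + G * x₂    ≈⟨ distribˡ G x₁ x₂ ⟨
      G * (x₁ + x₂)      ≈⟨ *-congˡ (/-+-≈0 F₁.D≉0 F₂.D≉0 cross≈0) ⟩
      G * 0#             ≈⟨ zeroʳ G ⟩
      0#                 ∎
      where
      module F₁ = Factorised (slots-1-1+ q≉0 M) nz₁
      module F₂ = Factorised (slots-2+-0 q≉0 M) nz₂
      Y  = pow q (suc M)
      G  = commonRatio F₁.common
      B₁ = bracket p κ sA sC sD (linPairs p (1# ∷ 1# ∷ [])) (linPairs p (qi ∷ Y ∷ []))
      B₂ = bracket p κ sA sC sD (linPairs p (1# ∷ Y ∷ [])) (linPairs p (qi ∷ 1# ∷ []))
      x₁ = (F₁.P * B₁) / D F₁.π F₁.σ
      x₂ = (F₂.P * B₂) / D F₂.π F₂.σ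
      U₁≈U₂ : U F₁.π F₁.σ ≈ U F₂.π F₂.σ
      U₁≈U₂ = *-cong (per a) (*-cong (per b) (per Δ))
        where
        per : ∀ v → F₁.π v * F₁.σ v ≈ F₂.π v * F₂.σ v
        per v = solve 3 (λ v qi Y → linFactorsE (𝟙 ∷ 𝟙 ∷ []) v ⊗ linFactorsE (qi ∷ Y ∷ []) v
                                  ⊜ linFactorsE (𝟙 ∷ Y ∷ []) v ⊗ linFactorsE (qi ∷ 𝟙 ∷ []) v) refl v qi Y
      cross≈0 : (F₁.P * B₁) * D F₂.π F₂.σ + (F₂.P * B₂) * D F₁.π F₁.σ ≈ 0#
      cross≈0 = begin
        (F₁.P * B₁) * (F₂.π q * U F₂.π F₂.σ) + (F₂.P * B₂) * (F₁.π q * U F₁.π F₁.σ)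
          ≈⟨ +-congˡ (*-congˡ (*-congˡ U₁≈U₂)) ⟩
        (F₁.P * B₁) * (F₂.π q * U₂) + (F₂.P * B₂) * (F₁.π q * U₂)
          ≈⟨ solve 7 (λ p q qi Y U B₁ B₂ →
               (linFactorsE (qi ∷ Y ∷ []) (p ⊗ qi) ⊗ B₁) ⊗ (linFactorsE (𝟙 ∷ Y ∷ []) q ⊗ U)
               ⊕ (linFactorsE (qi ∷ 𝟙 ∷ []) (p ⊗ qi) ⊗ B₂) ⊗ (linFactorsE (𝟙 ∷ 𝟙 ∷ []) q ⊗ U)
               ⊜ ((𝟙 ⊖ p ⊗ qi ⊗ qi) ⊗ (𝟙 ⊖ q) ⊗ U)
                 ⊗ ((𝟙 ⊖ p ⊗ qi ⊗ Y) ⊗ (𝟙 ⊖ q ⊗ Y) ⊗ B₁ ⊕ (𝟙 ⊖ p ⊗ qi) ⊗ (𝟙 ⊖ q) ⊗ B₂)) refl p q qi Y U₂ B₁ B₂ ⟩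
        ((1# - p * qi * qi) * (1# - q) * U₂) * ((1# - p * qi * Y) * (1# - q * Y) * B₁ + (1# - p * qi) * (1# - q) * B₂)
          ≈⟨ *-congˡ (edge-cancellation Y) ⟩
        _ * 0#
          ≈⟨ zeroʳ _ ⟩
        0# ∎
        where U₂ = U F₂.π F₂.σ

    module Generic (K M : ℕ) where
      X Y : Carrier
      X = pow q (suc K)
      Y = pow q (suc M)

      symmetricPart : Carrier → Carrier → Carrier
      symmetricPart X Y = (1# - p * qi * X) * (1# - p * qi * Y) * (p * X * Y - 1#)

      N : Carrier → Carrier → Carrier
      N X Y = qi * genericCoefficient p κ sA sC sD * ((1# - p * qi * qi) * (1# - p * qi)) * symmetricPart X Y

      Uᵍ : Carrier → Carrier → Carrier
      Uᵍ X Y = U (linFactors (1# ∷ X ∷ 1# ∷ [])) (linFactors (qi ∷ 1# ∷ Y ∷ []))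

      W : Carrier
      W = commonRatio (λ x → poch (x * q) q K * poch (x * q) q M) * (N X Y / ((1# - q) * (1# - q) * Uᵍ X Y))

    W-sym : ∀ K M → Generic.W K M ≈ Generic.W M K
    W-sym K M = *-cong (commonRatio-cong (λ x → *-comm _ _))
                       (/-cong (*-congˡ symmetric) (*-congˡ (*-cong (per a) (*-cong (per b) (per Δ)))))
      where
      open Generic K M using (X; Y; symmetricPart)
      symmetric : symmetricPart X Y ≈ symmetricPart Y X
      symmetric = solve 4 (λ p qi X Y → (𝟙 ⊖ p ⊗ qi ⊗ X) ⊗ (𝟙 ⊖ p ⊗ qi ⊗ Y) ⊗ (p ⊗ X ⊗ Y ⊖ 𝟙)
                                      ⊜ (𝟙 ⊖ p ⊗ qi ⊗ Y) ⊗ (𝟙 ⊖ p ⊗ qi ⊗ X) ⊗ (p ⊗ Y ⊗ X ⊖ 𝟙)) refl p qi X Y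
      per : ∀ v → linFactors (1# ∷ X ∷ 1# ∷ []) v * linFactors (qi ∷ 1# ∷ Y ∷ []) v
                ≈ linFactors (1# ∷ Y ∷ 1# ∷ []) v * linFactors (qi ∷ 1# ∷ X ∷ []) v
      per v = solve 4 (λ v qi X Y → linFactorsE (𝟙 ∷ X ∷ 𝟙 ∷ []) v ⊗ linFactorsE (qi ∷ 𝟙 ∷ Y ∷ []) v
                                  ⊜ linFactorsE (𝟙 ∷ Y ∷ 𝟙 ∷ []) v ⊗ linFactorsE (qi ∷ 𝟙 ∷ X ∷ []) v) refl v qi X Y

    core-2+-1+ : ∀ K M → DenominatorsNonzero (suc (suc K)) (suc M) →
                 core (suc (suc K)) (suc M) ≈ (Generic.X K M - Generic.Y K M) * Generic.W K M
    core-2+-1+ K M nz = begin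
      core (suc (suc K)) (suc M)          ≈⟨ F.core≈ ⟩
      G * ((F.P * B) / D F.π F.σ)          ≈⟨ *-congˡ (/-cong P*B≈ D≈) ⟩
      G * ((T * Z) / (T * D'))             ≈⟨ *-congˡ (/-cancelˡ T≉0 D'≉0) ⟩
      G * (Z / D')                         ≈⟨ *-congˡ (*-assoc (X - Y) (N X Y) _) ⟩
      G * ((X - Y) * (N X Y / D'))         ≈⟨ x∙yz≈y∙xz G (X - Y) _ ⟩
      (X - Y) * W                          ∎
      where
      open Generic K M
      module F = Factorised (slots-2+-1+ q≉0 K M) nz
      G  = commonRatio F.common
      B  = bracket p κ sA sC sD (linPairs p (1# ∷ X ∷ 1# ∷ [])) (linPairs p (qi ∷ 1# ∷ Y ∷ []))
      T  = 1# - q * X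
      Z  = (X - Y) * N X Y
      D' = (1# - q) * (1# - q) * Uᵍ X Y
      Kc = genericCoefficient p κ sA sC sD
      qi-X≈ : qi - X ≈ qi * T
      qi-X≈ = sym (trans (solve 3 (λ qi q X → qi ⊗ (𝟙 ⊖ q ⊗ X) ⊜ qi ⊖ (qi ⊗ q) ⊗ X) refl qi q X)
                         (+-congˡ (-‿cong (trans (*-congʳ (⁻¹-inverseˡ q≉0)) (*-identityˡ X)))))
      P*B≈ : F.P * B ≈ T * Z
      P*B≈ = begin
        F.P * B
          ≈⟨ *-congˡ (bracket-generic p κ sA sC sD qi X Y) ⟩
        F.P * ((X - Y) * (Kc * ((qi - X) * ((1# - p * qi * X) * (p * X * Y - 1#)))))
          ≈⟨ *-congˡ (*-congˡ (*-congˡ (*-congʳ qi-X≈))) ⟩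
        F.P * ((X - Y) * (Kc * ((qi * T) * ((1# - p * qi * X) * (p * X * Y - 1#)))))
          ≈⟨ solve 6 (λ p q qi X Y Kc →
               linFactorsE (qi ∷ 𝟙 ∷ Y ∷ []) (p ⊗ qi)
                 ⊗ ((X ⊖ Y) ⊗ (Kc ⊗ ((qi ⊗ (𝟙 ⊖ q ⊗ X)) ⊗ ((𝟙 ⊖ p ⊗ qi ⊗ X) ⊗ (p ⊗ X ⊗ Y ⊖ 𝟙)))))
               ⊜ (𝟙 ⊖ q ⊗ X) ⊗ ((X ⊖ Y) ⊗ (qi ⊗ Kc ⊗ ((𝟙 ⊖ p ⊗ qi ⊗ qi) ⊗ (𝟙 ⊖ p ⊗ qi))
                   ⊗ ((𝟙 ⊖ p ⊗ qi ⊗ X) ⊗ (𝟙 ⊖ p ⊗ qi ⊗ Y) ⊗ (p ⊗ X ⊗ Y ⊖ 𝟙))))) refl p q qi X Y Kc ⟩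
        T * Z ∎
      D≈ : D F.π F.σ ≈ T * D'
      D≈ = solve 3 (λ q X U → linFactorsE (𝟙 ∷ X ∷ 𝟙 ∷ []) q ⊗ U
                            ⊜ (𝟙 ⊖ q ⊗ X) ⊗ ((𝟙 ⊖ q) ⊗ (𝟙 ⊖ q) ⊗ U)) refl q X (Uᵍ X Y)
      T≉0  = ≉0-*ˡ (≉0-resp D≈ F.D≉0)
      D'≉0 = ≉0-*ʳ (≉0-resp D≈ F.D≉0)

    module _ (nz : ∀ k m → DenominatorsNonzero k m) where

      core-0 : ∀ m → core 0 m ≈ 0#
      core-0 zero    = core-0-0 (nz 0 0)
      core-0 (suc M) = core-0-1+ M (nz 0 (suc M))

      core-diagonal : ∀ k → core (suc k) k ≈ 0#
      core-diagonal zero    = core-1-0 (nz 1 0)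
      core-diagonal (suc K) = begin
        core (suc (suc K)) (suc K)       ≈⟨ core-2+-1+ K K (nz _ _) ⟩
        (X - X) * Generic.W K K          ≈⟨ *-congʳ (-‿inverseʳ X) ⟩
        0# * Generic.W K K               ≈⟨ zeroˡ _ ⟩
        0#                               ∎
        where X = pow q (suc K)

      core-antisymmetric : ∀ k m → core (suc k) m + core (suc m) k ≈ 0#
      core-antisymmetric zero    zero    = trans (+-cong (core-1-0 (nz 1 0)) (core-1-0 (nz 1 0))) (+-identityʳ 0#)
      core-antisymmetric zero    (suc M) = core-1-1+ M (nz _ _) (nz _ _)
      core-antisymmetric (suc K) zero    = trans (+-comm _ _) (core-1-1+ K (nz _ _) (nz _ _))
      core-antisymmetric (suc K) (suc M) = begin
        core (suc (suc K)) (suc M) + core (suc (suc M)) (suc K)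
          ≈⟨ +-cong (core-2+-1+ K M (nz _ _)) (trans (core-2+-1+ M K (nz _ _)) (*-congˡ (sym (W-sym K M)))) ⟩
        (X - Y) * Generic.W K M + (Y - X) * Generic.W K M
          ≈⟨ solve 3 (λ X Y W → (X ⊖ Y) ⊗ W ⊕ (Y ⊖ X) ⊗ W ⊜ Κ (+ 0)) refl X Y (Generic.W K M) ⟩
        0# ∎
        where
        X = pow q (suc K)
        Y = pow q (suc M)

module SeriesTerms {ℓ₁ ℓ₂} (F : Field ℓ₁ ℓ₂) (q : Field.Carrier F) where
  open Field F hiding (zero)
  open FieldDefs F
  open FieldProperties F
  open Pochhammer F q
  open IntegerCoefficientSolver commutativeRing
  open import Algebra.Properties.CommutativeSemigroup *-commutativeSemigroup using (interchange)
  open import Relation.Binary.Reasoning.Setoid setoid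

  θ : ℕ → Carrier
  θ n = pow (- 1#) n * pow q (n C 2)

  exponent : List Carrier → List Carrier → ℤ
  exponent αs βs = (+ (suc (length βs))) ℤ.- (+ (length αs))

  tail : List Carrier → List Carrier → ℤ → Carrier → ℕ → Carrier
  tail E F z w n = pochs E q n / pochs F q n * (ipow (θ n) z * pow w n)

  phi-split : ∀ ns ds E F w n → poch q q n * pochs (ds ++ F) q n ≉0 →
              phi (ns ++ E) (ds ++ F) q w n ≈ ratio ns ds n * tail E F (exponent (ns ++ E) (ds ++ F)) w n
  phi-split ns ds E F w n den≉0 = begin
    pochs (ns ++ E) q n / pochs ((q ∷ ds) ++ F) q n * I * pow w n
      ≈⟨ *-congʳ (*-congʳ (/-cong (pochs-++ ns E n) (pochs-++ (q ∷ ds) F n))) ⟩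
    (pochs ns q n * pochs E q n) / (pochs (q ∷ ds) q n * pochs F q n) * I * pow w n
      ≈⟨ *-congʳ (*-congʳ (/-*-interchange (≉0-*ˡ split≉0) (≉0-*ʳ split≉0))) ⟨
    ratio ns ds n * (pochs E q n / pochs F q n) * I * pow w n
      ≈⟨ trans (*-assoc _ _ _) (*-assoc _ _ _) ⟩
    ratio ns ds n * tail E F (exponent (ns ++ E) (ds ++ F)) w n ∎
    where
    I = ipow (θ n) (exponent (ns ++ E) (ds ++ F))
    split≉0 : pochs (q ∷ ds) q n * pochs F q n ≉0
    split≉0 = ≉0-resp (pochs-++ (q ∷ ds) F n) den≉0

  module _ (q≉0 : q ≉0) where

    θ-≉0 : ∀ n → θ n ≉0
    θ-≉0 n = ≉0-* (pow-≉0 n -1≉0) (pow-≉0 (n C 2) q≉0)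

    θ-suc : ∀ n → θ (suc n) ≈ θ n * (- 1# * pow q n)
    θ-suc n = begin
      pow (- 1#) n * - 1# * pow q (suc n C 2)           ≡⟨ ≡.cong (λ j → pow (- 1#) n * - 1# * pow q j) suc-C2 ⟨
      pow (- 1#) n * - 1# * pow q (n ℕ.+ n C 2)         ≈⟨ *-congˡ (pow-+ q n (n C 2)) ⟩
      pow (- 1#) n * - 1# * (pow q n * pow q (n C 2))   ≈⟨ solve 4 (λ s m x y → s ⊗ m ⊗ (x ⊗ y) ⊜ s ⊗ y ⊗ (m ⊗ x)) refl _ _ _ _ ⟩
      θ n * (- 1# * pow q n)                            ∎
      where
      suc-C2 : n ℕ.+ n C 2 ≡ suc n C 2
      suc-C2 = ≡.trans (≡.cong (ℕ._+ n C 2) (≡.sym (nC1≡n n))) (nCk+nC[k+1]≡[n+1]C[k+1] n 1)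

    θ-shift-sym : ∀ k m → θ (suc k) * (θ m * pow q m) ≈ θ (suc m) * (θ k * pow q k)
    θ-shift-sym k m = begin
      θ (suc k) * (θ m * pow q m)                 ≈⟨ *-congʳ (θ-suc k) ⟩
      θ k * (- 1# * pow q k) * (θ m * pow q m)    ≈⟨ solve 5 (λ t u s x y → t ⊗ (s ⊗ x) ⊗ (u ⊗ y) ⊜ u ⊗ (s ⊗ y) ⊗ (t ⊗ x)) refl _ _ _ _ _ ⟩
      θ m * (- 1# * pow q m) * (θ k * pow q k)    ≈⟨ *-congʳ (θ-suc m) ⟨
      θ (suc m) * (θ k * pow q k)                 ∎

    sign-part : ∀ z k m → ipow (θ (suc k)) z * pow 1# (suc k) * (ipow (θ m) z * pow (ipow q z) m)
                          ≈ ipow (θ (suc k) * (θ m * pow q m)) z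
    sign-part z k m = begin
      ipow (θ (suc k)) z * pow 1# (suc k) * (ipow (θ m) z * pow (ipow q z) m)
        ≈⟨ *-cong (trans (*-congˡ (pow-1# (suc k))) (*-identityʳ _)) (*-congˡ (pow-ipow m z q≉0)) ⟩
      ipow (θ (suc k)) z * (ipow (θ m) z * ipow (pow q m) z)
        ≈⟨ *-congˡ (ipow-distrib-* z (θ-≉0 m) (pow-≉0 m q≉0)) ⟨
      ipow (θ (suc k)) z * ipow (θ m * pow q m) z
        ≈⟨ ipow-distrib-* z (θ-≉0 (suc k)) (≉0-* (θ-≉0 m) (pow-≉0 m q≉0)) ⟨
      ipow (θ (suc k) * (θ m * pow q m)) z ∎

    ratio-part : ∀ E F → (∀ n → pochs F q n ≉0) → (∀ n → pochs (map (_* q) F) q n ≉0) → ∀ k m →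
      pochs E q (suc k) / pochs F q (suc k) * (pochs (map (_* q) E) q m / pochs (map (_* q) F) q m)
      ≈ pochs E q (suc m) / pochs F q (suc m) * (pochs (map (_* q) E) q k / pochs (map (_* q) F) q k)
    ratio-part E F F≉0 Fq≉0 k m = begin
      _ ≈⟨ /-*-interchange (F≉0 (suc k)) (Fq≉0 m) ⟩
      _ ≈⟨ /-cong (pochs-shift-sym E k m) (pochs-shift-sym F k m) ⟩
      _ ≈⟨ /-*-interchange (F≉0 (suc m)) (Fq≉0 k) ⟨
      _ ∎

    tail-shift-sym : ∀ E F → (∀ n → pochs F q n ≉0) → (∀ n → pochs (map (_* q) F) q n ≉0) → ∀ z k m →
      tail E F z 1# (suc k) * tail (map (_* q) E) (map (_* q) F) z (ipow q z) m
      ≈ tail E F z 1# (suc m) * tail (map (_* q) E) (map (_* q) F) z (ipow q z) k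
    tail-shift-sym E F F≉0 Fq≉0 z k m = begin
      _ ≈⟨ interchange _ _ _ _ ⟩
      _ ≈⟨ *-cong (ratio-part E F F≉0 Fq≉0 k m)
                  (trans (sign-part z k m) (trans (ipow-cong z (θ-shift-sym k m)) (sym (sign-part z m k)))) ⟩
      _ ≈⟨ interchange _ _ _ _ ⟩
      _ ∎

module AntidiagonalSums {ℓ₁ ℓ₂} (F : Field ℓ₁ ℓ₂) where
  open Field F hiding (zero)
  open FieldDefs F
  open IntegerCoefficientSolver commutativeRing
  open import Relation.Binary.Reasoning.Setoid setoid

  antidiagonal : (ℕ → ℕ → Carrier) → ℕ → Carrier
  antidiagonal g zero    = g 0 0
  antidiagonal g (suc n) = g 0 (suc n) + antidiagonal (λ i j → g (suc i) j) n

  sumTo-peel : ∀ f n → sumTo f (suc n) ≈ f 0 + sumTo (λ k → f (suc k)) n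
  sumTo-peel f zero    = refl
  sumTo-peel f (suc n) = trans (+-congʳ (sumTo-peel f n)) (+-assoc _ _ _)

  sumTo-antidiagonal : ∀ g n → sumTo (λ k → g k (n ∸ k)) n ≈ antidiagonal g n
  sumTo-antidiagonal g zero    = refl
  sumTo-antidiagonal g (suc n) =
    trans (sumTo-peel _ n) (+-congˡ (sumTo-antidiagonal (λ i j → g (suc i) j) n))

  antidiagonal-snoc : ∀ g n → antidiagonal g (suc n) ≈ antidiagonal (λ i j → g i (suc j)) n + g (suc n) 0
  antidiagonal-snoc g zero    = refl
  antidiagonal-snoc g (suc n) =
    trans (+-congˡ (antidiagonal-snoc (λ i j → g (suc i) j) n)) (sym (+-assoc _ _ _))

  antidiagonal-antisymmetric : ∀ g → (∀ i j → g i j + g j i ≈ 0#) → (∀ i → g i i ≈ 0#) →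
                               ∀ n → antidiagonal g n ≈ 0#
  antidiagonal-antisymmetric g anti diag zero          = diag 0
  antidiagonal-antisymmetric g anti diag (suc zero)    = anti 0 1
  antidiagonal-antisymmetric g anti diag (suc (suc n)) = begin
    g 0 (suc (suc n)) + antidiagonal (λ i j → g (suc i) j) (suc n)
      ≈⟨ +-congˡ (antidiagonal-snoc (λ i j → g (suc i) j) n) ⟩
    g 0 (suc (suc n)) + (antidiagonal (λ i j → g (suc i) (suc j)) n + g (suc (suc n)) 0)
      ≈⟨ +-congˡ (+-congʳ (antidiagonal-antisymmetric _ (λ i j → anti (suc i) (suc j)) (λ i → diag (suc i)) n)) ⟩
    g 0 (suc (suc n)) + (0# + g (suc (suc n)) 0)
      ≈⟨ trans (+-congˡ (+-identityˡ _)) (anti 0 (suc (suc n))) ⟩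
    0# ∎

  sumTo-linear : ∀ x y z f g h n →
    sumTo (λ k → x * f k - y * g k + z * h k) n ≈ x * sumTo f n - y * sumTo g n + z * sumTo h n
  sumTo-linear x y z f g h zero    = refl
  sumTo-linear x y z f g h (suc n) = trans (+-congʳ (sumTo-linear x y z f g h n))
    (solve 9 (λ x y z F G H f g h → (x ⊗ F ⊖ y ⊗ G ⊕ z ⊗ H) ⊕ (x ⊗ f ⊖ y ⊗ g ⊕ z ⊗ h)
                                   ⊜ x ⊗ (F ⊕ f) ⊖ y ⊗ (G ⊕ g) ⊕ z ⊗ (H ⊕ h))
      refl x y z (sumTo f n) (sumTo g n) (sumTo h n) (f (suc n)) (g (suc n)) (h (suc n)))

  convolution-vanishes : ∀ h → (∀ m → h 0 m ≈ 0#) → (∀ k m → h (suc k) m + h (suc m) k ≈ 0#) →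
                         (∀ k → h (suc k) k ≈ 0#) → ∀ n → sumTo (λ k → h k (n ∸ k)) n ≈ 0#
  convolution-vanishes h first anti diag n = trans (sumTo-antidiagonal h n) (vanishes n)
    where
    vanishes : ∀ n → antidiagonal h n ≈ 0#
    vanishes zero    = first 0
    vanishes (suc n) = trans (+-cong (first (suc n)) (antidiagonal-antisymmetric _ anti diag n)) (+-identityʳ 0#)

[k+m]-[k+n]≡m-n : ∀ k m n → (+ (k ℕ.+ m)) ℤ.- (+ (k ℕ.+ n)) ≡ (+ m) ℤ.- (+ n)
[k+m]-[k+n]≡m-n zero    m n = ≡.refl
[k+m]-[k+n]≡m-n (suc k) m n = begin
  (+ suc (k ℕ.+ m)) ℤ.- (+ suc (k ℕ.+ n))  ≡⟨ ℤ.m-n≡m⊖n (suc (k ℕ.+ m)) (suc (k ℕ.+ n)) ⟩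
  suc (k ℕ.+ m) ℤ.⊖ suc (k ℕ.+ n)          ≡⟨ ℤ.[1+m]⊖[1+n]≡m⊖n (k ℕ.+ m) (k ℕ.+ n) ⟩
  (k ℕ.+ m) ℤ.⊖ (k ℕ.+ n)                  ≡⟨ ℤ.m-n≡m⊖n (k ℕ.+ m) (k ℕ.+ n) ⟨
  (+ (k ℕ.+ m)) ℤ.- (+ (k ℕ.+ n))          ≡⟨ [k+m]-[k+n]≡m-n k m n ⟩
  (+ m) ℤ.- (+ n)                          ∎
  where open ≡.≡-Reasoning

module ConvolutionIdentity {ℓ₁ ℓ₂} (F : Field ℓ₁ ℓ₂) (q a b c d : Field.Carrier F) (E Fs : List (Field.Carrier F)) (z : ℤ) where
  open Field F hiding (zero)
  open FieldDefs F
  open FieldProperties F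
  open Pochhammer F q
  open ThreeTermCore F q a b c d
  open SeriesTerms F q
  open AntidiagonalSums F
  open IntegerCoefficientSolver commutativeRing
  open import Relation.Binary.Reasoning.Setoid setoid

  Eq Fq : List Carrier
  Eq = map (_* q) E
  Fq = map (_* q) Fs

  w : Carrier
  w = ipow q z

  φ₁ φ₂ φ₃ φ₄ φ₅ φ₆ : ℕ → Carrier
  φ₁ = phi (numL₁ ++ E) (denL₁ ++ Fs) q 1#
  φ₂ = phi (numR₁ ++ Eq) (denR₁ ++ Fq) q w
  φ₃ = phi (numL₂ ++ E) (denL₂ ++ Fs) q 1#
  φ₄ = phi (numR₂ ++ Eq) (denR₂ ++ Fq) q w
  φ₅ = phi (numL₃ ++ E) (denL₃ ++ Fs) q 1#
  φ₆ = phi (numR₃ ++ Eq) (denR₃ ++ Fq) q w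

  τ : ℕ → ℕ → Carrier
  τ k m = C₁ * (φ₁ k * φ₂ m) - C₂ * (φ₃ k * φ₄ m) + C₃ * (φ₅ k * φ₆ m)

  module _ (q≉0 : q ≉0) (a≉0 : a ≉0) (d≉0 : d ≉0) (z≡ : z ≡ (+ length Fs) ℤ.- (+ length E))
           (D₁ : Defined (numL₁ ++ E) (denL₁ ++ Fs) q) (D₂ : Defined (numR₁ ++ Eq) (denR₁ ++ Fq) q)
           (D₃ : Defined (numL₂ ++ E) (denL₂ ++ Fs) q) (D₄ : Defined (numR₂ ++ Eq) (denR₂ ++ Fq) q)
           (D₅ : Defined (numL₃ ++ E) (denL₃ ++ Fs) q) (D₆ : Defined (numR₃ ++ Eq) (denR₃ ++ Fq) q) where

    tailL tailR : ℕ → Carrier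
    tailL = tail E Fs z 1#
    tailR = tail Eq Fq z w

    private
      zL : exponent (numL₁ ++ E) (denL₁ ++ Fs) ≡ z
      zL = ≡.trans ([k+m]-[k+n]≡m-n 4 (length Fs) (length E)) (≡.sym z≡)

      zR : exponent (numR₁ ++ Eq) (denR₁ ++ Fq) ≡ z
      zR = ≡.trans ([k+m]-[k+n]≡m-n 4 (length Fq) (length Eq))
                   (≡.trans (≡.cong₂ (λ m n → (+ m) ℤ.- (+ n)) (List.length-map (_* q) Fs) (List.length-map (_* q) E))
                            (≡.sym z≡))

      splitL : ∀ ns ds → Defined (ns ++ E) (ds ++ Fs) q → exponent (ns ++ E) (ds ++ Fs) ≡ z →
               ∀ k → phi (ns ++ E) (ds ++ Fs) q 1# k ≈ ratio ns ds k * tailL k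
      splitL ns ds D z'≡z k =
        trans (phi-split ns ds E Fs 1# k (D k)) (*-congˡ (reflexive (≡.cong (λ z' → tail E Fs z' 1# k) z'≡z)))

      splitR : ∀ ns ds → Defined (ns ++ Eq) (ds ++ Fq) q → exponent (ns ++ Eq) (ds ++ Fq) ≡ z →
               ∀ m → phi (ns ++ Eq) (ds ++ Fq) q w m ≈ ratio ns ds m * tailR m
      splitR ns ds D z'≡z m =
        trans (phi-split ns ds Eq Fq w m (D m)) (*-congˡ (reflexive (≡.cong (λ z' → tail Eq Fq z' w m) z'≡z)))

      split-≉0 : ∀ ds G → (∀ n → poch q q n * pochs (ds ++ G) q n ≉0) → ∀ n → pochs (q ∷ ds) q n * pochs G q n ≉0
      split-≉0 ds G D n = ≉0-resp (pochs-++ (q ∷ ds) G n) (D n)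

      nz : ∀ k m → DenominatorsNonzero k m
      nz k m = record
        { L₁ = ≉0-*ˡ (split-≉0 denL₁ Fs D₁ k) ; R₁ = ≉0-*ˡ (split-≉0 denR₁ Fq D₂ m)
        ; L₂ = ≉0-*ˡ (split-≉0 denL₂ Fs D₃ k) ; R₂ = ≉0-*ˡ (split-≉0 denR₂ Fq D₄ m)
        ; L₃ = ≉0-*ˡ (split-≉0 denL₃ Fs D₅ k) ; R₃ = ≉0-*ˡ (split-≉0 denR₃ Fq D₆ m)
        }

    τ≈ : ∀ k m → τ k m ≈ (tailL k * tailR m) * core k m
    τ≈ k m = begin
      τ k m
        ≈⟨ +-cong (+-cong (*-congˡ (*-cong (splitL numL₁ denL₁ D₁ zL k) (splitR numR₁ denR₁ D₂ zR m)))
                          (-‿cong (*-congˡ (*-cong (splitL numL₂ denL₂ D₃ zL k) (splitR numR₂ denR₂ D₄ zR m)))))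
                  (*-congˡ (*-cong (splitL numL₃ denL₃ D₅ zL k) (splitR numR₃ denR₃ D₆ zR m))) ⟩
        C₁ * ((r₁ * t) * (r₂ * t')) - C₂ * ((r₃ * t) * (r₄ * t')) + C₃ * ((r₅ * t) * (r₆ * t'))
        ≈⟨ solve 11 (λ C₁ C₂ C₃ r₁ r₂ r₃ r₄ r₅ r₆ t t' →
             C₁ ⊗ ((r₁ ⊗ t) ⊗ (r₂ ⊗ t')) ⊖ C₂ ⊗ ((r₃ ⊗ t) ⊗ (r₄ ⊗ t')) ⊕ C₃ ⊗ ((r₅ ⊗ t) ⊗ (r₆ ⊗ t'))
             ⊜ (t ⊗ t') ⊗ (C₁ ⊗ (r₁ ⊗ r₂) ⊖ C₂ ⊗ (r₃ ⊗ r₄) ⊕ C₃ ⊗ (r₅ ⊗ r₆))) refl C₁ C₂ C₃ r₁ r₂ r₃ r₄ r₅ r₆ t t' ⟩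
      (tailL k * tailR m) * core k m ∎
      where
      t  = tailL k
      t' = tailR m
      r₁ = ratio numL₁ denL₁ k
      r₂ = ratio numR₁ denR₁ m
      r₃ = ratio numL₂ denL₂ k
      r₄ = ratio numR₂ denR₂ m
      r₅ = ratio numL₃ denL₃ k
      r₆ = ratio numR₃ denR₃ m

    τ-first : ∀ m → τ 0 m ≈ 0#
    τ-first m = trans (τ≈ 0 m) (trans (*-congˡ (core-0 q≉0 a≉0 d≉0 nz m)) (zeroʳ _))

    τ-diagonal : ∀ k → τ (suc k) k ≈ 0#
    τ-diagonal k = trans (τ≈ (suc k) k) (trans (*-congˡ (core-diagonal q≉0 a≉0 d≉0 nz k)) (zeroʳ _))

    τ-antisymmetric : ∀ k m → τ (suc k) m + τ (suc m) k ≈ 0#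
    τ-antisymmetric k m = begin
      τ (suc k) m + τ (suc m) k
        ≈⟨ +-cong (τ≈ (suc k) m) (trans (τ≈ (suc m) k) (*-congʳ (sym tails-sym))) ⟩
      t * core (suc k) m + t * core (suc m) k
        ≈⟨ distribˡ t _ _ ⟨
      t * (core (suc k) m + core (suc m) k)
        ≈⟨ *-congˡ (core-antisymmetric q≉0 a≉0 d≉0 nz k m) ⟩
      t * 0#
        ≈⟨ zeroʳ t ⟩
      0# ∎
      where
      t = tailL (suc k) * tailR m
      tails-sym : t ≈ tailL (suc m) * tailR k
      tails-sym = tail-shift-sym q≉0 E Fs (λ n → ≉0-*ʳ (split-≉0 denL₁ Fs D₁ n)) (λ n → ≉0-*ʳ (split-≉0 denR₁ Fq D₂ n)) z k m

    identity : ∀ N → C₁ * (φ₁ ⊛ φ₂) N ≈ C₂ * (φ₃ ⊛ φ₄) N - C₃ * (φ₅ ⊛ φ₆) N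
    identity N = begin
      X                  ≈⟨ solve 3 (λ X Y Z → X ⊜ (Y ⊖ Z) ⊕ (X ⊖ Y ⊕ Z)) refl X Y Z ⟩
      (Y - Z) + (X - Y + Z)
        ≈⟨ +-congˡ (trans (sym (sumTo-linear C₁ C₂ C₃ _ _ _ N)) (convolution-vanishes τ τ-first τ-antisymmetric τ-diagonal N)) ⟩
      (Y - Z) + 0#       ≈⟨ +-identityʳ _ ⟩
      Y - Z              ∎
      where
      X = C₁ * (φ₁ ⊛ φ₂) N
      Y = C₂ * (φ₃ ⊛ φ₄) N
      Z = C₃ * (φ₅ ⊛ φ₆) N

theorem1p1 : ∀ {c ℓ} (F : Field c ℓ) →
  let open Field F hiding (zero)
      open FieldDefs F
  in (q a b c d : Carrier) (r s : ℕ) (e : Vec Carrier r) (f : Vec Carrier s) →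
  let E   = toList e
      Eq  = map (λ x → x * q) (toList e)
      Fl  = toList f
      Fq  = map (λ x → x * q) (toList f)
      qi  = q ⁻¹
      w   = ipow q ((+ s) ℤ.- (+ r))
      A1  = (a ⁻¹ * b * c) ∷ (b * c * qi * qi) ∷ c ∷ (d * qi) ∷ E
      B1  = (a * qi) ∷ (b * qi) ∷ (b * c * d ⁻¹) ∷ Fl
      A2  = (a ⁻¹ * b * c) ∷ (b * c) ∷ c ∷ (d * q) ∷ Eq
      B2  = (a * q) ∷ (b * q) ∷ (b * c * d ⁻¹) ∷ Fq
      A3  = (a ⁻¹ * b * c) ∷ (b * c * qi * qi) ∷ (c * qi) ∷ d ∷ E
      B3  = (a * qi) ∷ b ∷ (b * c * d ⁻¹ * qi) ∷ Fl
      A4  = (a ⁻¹ * b * c) ∷ (b * c) ∷ (c * q) ∷ d ∷ Eq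
      B4  = (a * q) ∷ b ∷ (b * c * d ⁻¹ * q) ∷ Fq
      A5  = (a ⁻¹ * b * c * qi) ∷ (b * c * qi * qi) ∷ c ∷ d ∷ E
      B5  = a ∷ (b * qi) ∷ (b * c * d ⁻¹ * qi) ∷ Fl
      A6  = (a ⁻¹ * b * c * q) ∷ (b * c) ∷ c ∷ d ∷ Eq
      B6  = a ∷ (b * q) ∷ (b * c * d ⁻¹ * q) ∷ Fq
  in ¬ (q ≈ 0#) → ¬ (a ≈ 0#) → ¬ (d ≈ 0#) →
     Defined A1 B1 q → Defined A2 B2 q → Defined A3 B3 q →
     Defined A4 B4 q → Defined A5 B5 q → Defined A6 B6 q →
     ∀ N →
       ((a - b) * (a - c) * (b * c - d) * (1# - d))
         * ((phi A1 B1 q 1#) ⊛ (phi A2 B2 q w)) N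
       ≈ ((a - d) * (1# - b) * (1# - c) * (b * c - a * d))
           * ((phi A3 B3 q 1#) ⊛ (phi A4 B4 q w)) N
         - ((1# - a) * (b - d) * (c - d) * (a - b * c))
           * ((phi A5 B5 q 1#) ⊛ (phi A6 B6 q w)) N
theorem1p1 F q a b c d r s e f q≉0 a≉0 d≉0 =
  ConvolutionIdentity.identity F q a b c d (toList e) (toList f) ((+ s) ℤ.- (+ r)) q≉0 a≉0 d≉0
    (≡.cong₂ (λ m n → (+ m) ℤ.- (+ n)) (≡.sym (Vec.length-toList f)) (≡.sym (Vec.length-toList e)))
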